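{- Let $p\ge 3$ be a prime, $n$ a positive integer, $G=\mathbb{Z}_{N_p}$ with $N_p=(n+1)p$, $\psi$ a complex linear character of $G$ of order $o(\psi)$, and $k\ge1$. Define $$\delta_1^\psi(i)=\begin{cases}0,& o(\psi)\nmid i,\\ -(p-1)N_p/p,& o(\psi)\mid i,\end{cases}\qquad \delta_2^\psi(i)=\begin{cases}0,& (o(\psi)/p)\nmid i,\\ N_p/p,& (o(\psi)/p)\mid i\text{ and } o(\psi)\nmid i,\\ -(p-1)N_p/p,& o(\psi)\mid i.\end{cases}$$ Then (1) if $p\nmid o(\psi)$, $F_\psi(\overline{X}_{p,k})=(-1)^kZ_k(\delta_1^\psi(1),\ldots,\delta_1^\psi(k))$; and (2) if $p\mid o(\psi)$, $F_\psi(\overline{X}_{p,k})=(-1)^kZ_k(\delta_2^\psi(1),\ldots,\delta_2^\psi(k))$.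
   Context: $D_p\subset G$ is the set of residues modulo $N_p$ not divisible by $p$. $\overline{X}_{p,k}$ is the set of $k$-tuples in $D_p^k$ with pairwise distinct coordinates; $F_\psi(Y)=\sum_{(y_1,\ldots,y_k)\in Y}\prod_i\psi(y_i)$. $Z_k(t_1,\ldots,t_k)=\sum_{\sum_i ic_i=k}N(c_1,\ldots,c_k)t_1^{c_1}\cdots t_k^{c_k}$ with $N(c_1,\ldots,c_k)=k!/\prod_i i^{c_i}c_i!$. -}

module Defs where

open import Level using (Level)
open import Data.Nat as ℕ using (ℕ; zero; suc; _≤_; NonZero; _!)
open import Data.Nat.Properties using (m*n≢0; m^n≢0; _!≢0)
open import Data.Nat.Divisibility using (_∣_; _∣?_)
open import Data.Nat.DivMod using (_mod_)
open import Data.Nat.Primality using (Prime; prime⇒nonZero)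
open import Data.Integer as ℤ using (ℤ; +_; -[1+_])
open import Data.Fin as Fin using (Fin; toℕ)
open import Data.Fin.Properties as FinP using ()
open import Data.Vec as Vec using (Vec; []; _∷_; toList)
open import Data.List as List using (List; []; _∷_; concatMap; map; filter; foldr; allFin; upTo)
open import Data.List.Relation.Unary.All as All using (All; all?)
open import Data.List.Relation.Unary.Unique.Propositional using (Unique)
import Data.List.Relation.Unary.Unique.DecPropositional as UDec
open import Data.Product using (_×_)
open import Data.Sum using (_⊎_)
open import Relation.Nullary using (¬_; Dec; yes; no; ¬?)
open import Relation.Nullary.Decidable using (_×-dec_)
open import Relation.Unary using (Decidable)
open import Algebra.Bundles using (CommutativeRing)

Np : ℕ → ℕ → ℕ
Np n p = suc n ℕ.* p

Np-nonZero : ∀ n {p} → Prime p → NonZero (Np n p)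
Np-nonZero n pp = m*n≢0 (suc n) _ {{_}} {{prime⇒nonZero pp}}

G : ℕ → ℕ → Set
G n p = Fin (Np n p)

addG : ∀ n {p} → Prime p → G n p → G n p → G n p
addG n {p} pp a b = ((toℕ a ℕ.+ toℕ b) mod Np n p) {{Np-nonZero n pp}}

zeroG : ∀ n {p} → Prime p → G n p
zeroG n {p} pp = (0 mod Np n p) {{Np-nonZero n pp}}

InD : ∀ n p → G n p → Set
InD n p y = ¬ (p ∣ toℕ y)

tuples : ∀ {a} {A : Set a} → List A → (k : ℕ) → List (Vec A k)
tuples xs zero    = [] ∷ []
tuples xs (suc k) = concatMap (λ x → map (x ∷_) (tuples xs k)) xs

InXbar : ∀ n p k → Vec (G n p) k → Set
InXbar n p k v = All (InD n p) (toList v) × Unique (toList v)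

InXbar? : ∀ n p k → Decidable (InXbar n p k)
InXbar? n p k v =
  all? (λ y → ¬? (p ∣? toℕ y)) (toList v) ×-dec UDec.unique? Fin._≟_ (toList v)

Xbar : ∀ n p k → List (Vec (G n p) k)
Xbar n p k = filter (InXbar? n p k) (tuples (allFin (Np n p)) k)

module _ {c ℓ : Level} (R : CommutativeRing c ℓ) where
  open CommutativeRing R

  sumR : List Carrier → Carrier
  sumR = foldr _+_ 0#

  prodR : List Carrier → Carrier
  prodR = foldr _*_ 1#

  powR : Carrier → ℕ → Carrier
  powR x zero    = 1#
  powR x (suc m) = x * powR x m

  natR : ℕ → Carrier
  natR zero    = 0#
  natR (suc m) = 1# + natR m

  intR : ℤ → Carrier
  intR (+ m)      = natR m
  intR -[1+ m ]   = - natR (suc m)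

  IsIntegralDomain : Set (c Level.⊔ ℓ)
  IsIntegralDomain =
    (¬ (1# ≈ 0#)) × (∀ x y → x * y ≈ 0# → (x ≈ 0#) ⊎ (y ≈ 0#))

  CharZero : Set ℓ
  CharZero = ∀ m → ¬ (natR (suc m) ≈ 0#)

  -- a linear character G → R^×: a group homomorphism into the
  -- multiplicative monoid (values are then automatically units)
  record IsCharacter (n : ℕ) {p : ℕ} (pp : Prime p) (ψ : G n p → Carrier)
         : Set (c Level.⊔ ℓ) where
    field
      hom  : ∀ a b → ψ (addG n pp a b) ≈ ψ a * ψ b
      unit : ψ (zeroG n pp) ≈ 1#

  IsOrder : ∀ n p → (G n p → Carrier) → ℕ → Set ℓ
  IsOrder n p ψ o = (1 ≤ o)
              × (∀ x → powR (ψ x) o ≈ 1#)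
              × (∀ m → 1 ≤ m → (∀ x → powR (ψ x) m ≈ 1#) → o ≤ m)

  Fψ : ∀ n p {k} → (G n p → Carrier) → List (Vec (G n p) k) → Carrier
  Fψ n p ψ Y = sumR (map (λ y → prodR (map ψ (toList y))) Y)

-- The cycle index Z_k(t_1,…,t_k) (over ℤ)
-- c = (c_1,…,c_k) is a Vec ℕ k; position j (0-based) holds c_{j+1}.

weight : ∀ {m} → ℕ → Vec ℕ m → ℕ
weight j []       = 0
weight j (c ∷ cs) = suc j ℕ.* c ℕ.+ weight (suc j) cs

den : ∀ {m} → ℕ → Vec ℕ m → ℕ
den j []       = 1
den j (c ∷ cs) = (suc j ℕ.^ c ℕ.* c !) ℕ.* den (suc j) cs

den-nonZero : ∀ {m} j (cs : Vec ℕ m) → NonZero (den j cs)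
den-nonZero j []       = _
den-nonZero j (c ∷ cs) =
  m*n≢0 _ _ {{m*n≢0 _ _ {{m^n≢0 (suc j) c}} {{c !≢0}}}} {{den-nonZero (suc j) cs}}

Ncoef : (k : ℕ) → Vec ℕ k → ℕ
Ncoef k cs = ℕ._/_ (k !) (den 0 cs) {{den-nonZero 0 cs}}

mono : ∀ {m} → (ℕ → ℤ) → ℕ → Vec ℕ m → ℤ
mono t j []       = + 1
mono t j (c ∷ cs) = (t (suc j) ℤ.^ c) ℤ.* mono t (suc j) cs

-- all (c_1,…,c_k) ∈ ℕ^k with Σ_i i c_i = k (each c_i ≤ k necessarily)
partitionsOf : (k : ℕ) → List (Vec ℕ k)
partitionsOf k = filter (λ cs → weight 0 cs ℕ.≟ k) (tuples (upTo (suc k)) k)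

Z : (k : ℕ) → (ℕ → ℤ) → ℤ
Z k t = foldr ℤ._+_ (+ 0)
          (map (λ cs → + Ncoef k cs ℤ.* mono t 0 cs) (partitionsOf k))

module _ (n : ℕ) {p : ℕ} (pp : Prime p) (o : ℕ) where
  private instance _ = prime⇒nonZero pp

  Np/p : ℕ
  Np/p = Np n p ℕ./ p

  δ₁ : ℕ → ℤ
  δ₁ i with o ∣? i
  ... | yes _ = ℤ.- (+ (p ℕ.∸ 1) ℤ.* + Np/p)
  ... | no  _ = + 0

  δ₂ : ℕ → ℤ
  δ₂ i with (o ℕ./ p) ∣? i | o ∣? i
  ... | no  _ | _     = + 0
  ... | yes _ | no  _ = + Np/p
  ... | yes _ | yes _ = ℤ.- (+ (p ℕ.∸ 1) ℤ.* + Np/p)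

{-# OPTIONS --safe #-}
module Submission where

-- Let E_k be the sum of ∏ ψ(y_i) over k-tuples of pairwise distinct elements of D_p, so that
-- F_ψ(X̄_{p,k}) = E_k, and let p_m = ∑_{y ∈ D_p} ψ(y)^m. Dropping the condition that the first
-- coordinate differs from the others and correcting for the coincidences gives Newton's recursion
-- E_{k+1} = ∑_{i+j=k} (-1)^i (k!/j!) p_{i+1} E_j. Lowering one exponent c_i in
-- k Z_k = ∑_c (∑_i i c_i) N(c) t^c shows that the cycle index satisfies the same recursion
-- Z_{k+1} = ∑_{i+j=k} (k!/j!) t_{i+1} Z_j, hence E_k = (-1)^k Z_k(-p_1, …, -p_k). Finally, with
-- ζ = ψ(1) of order o(ψ), p_m = ∑_{a < N_p} ζ^{ma} − ∑_{b ≤ n} ζ^{mpb}, and a geometric sum of a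
-- root of unity over a full period is its length or 0 according as the root is 1; this gives
-- p_m = −δ(m).

open import Level using (Level)
open import Data.Nat as ℕ using (ℕ; zero; suc)
open import Data.List using (List; []; _∷_; map; filter; concatMap; upTo; applyUpTo; replicate; allFin; tabulate; _++_)
open import Data.Product using (_×_; _,_; proj₁; proj₂)
open import Data.Sum using (inj₁; inj₂)
open import Data.Empty using (⊥-elim)
open import Data.Vec using (Vec; []; _∷_; toList)
open import Data.Fin as Fin using (Fin; toℕ)
open import Data.Nat.Divisibility using (_∣?_; divides; ∣-refl; ∣m+n∣m⇒∣n; ∣m∣n⇒∣m+n; >⇒∤)
open import Relation.Nullary using (¬_; Dec; yes; no; ¬?)
open import Relation.Binary.Definitions using (DecidableEquality)
open import Data.List.Membership.Propositional using () renaming (_∈_ to _∈ₚ_)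
open import Data.List.Relation.Unary.All as All using (All; []; _∷_)
open import Data.List.Relation.Unary.Any using (here; there)
open import Data.List.Relation.Unary.AllPairs using ([]; _∷_)
open import Data.List.Relation.Unary.Unique.Propositional using (Unique)
open import Relation.Nullary.Decidable using (_×-dec_)
open import Relation.Unary using (Decidable)
open import Function using (_∘_)
open import Algebra.Bundles using (CommutativeRing)
import Relation.Binary.Reasoning.Setoid as SetoidReasoning
open import Relation.Binary.PropositionalEquality as ≡ using (_≡_; _≢_)
open import Defs
open import Data.Nat.Primality using (Prime; prime⇒nonZero)
import Data.Nat.Properties as NP
open import Data.Nat.Induction using (<-rec)
open import Data.Integer as ℤ using (ℤ; +_; -[1+_])
import Data.Integer.Properties as ZP
open import Data.Sign as Sign using (Sign)

module RingSums {c ℓ : Level} (R : CommutativeRing c ℓ) where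
  open CommutativeRing R
  open SetoidReasoning setoid
  open import Algebra.Properties.CommutativeSemigroup +-commutativeSemigroup using () renaming (interchange to +-interchange)

  ∑ : ∀ {a} {A : Set a} → List A → (A → Carrier) → Carrier
  ∑ xs f = sumR R (map f xs)

  when : ∀ {p} {P : Set p} → Dec P → Carrier → Carrier
  when (yes _) x = x
  when (no _)  x = 0#

  ∑< : ℕ → (ℕ → Carrier) → Carrier
  ∑< zero    f = 0#
  ∑< (suc B) f = f 0 + ∑< B (f ∘ suc)

  ∑from : ℕ → ℕ → (ℕ → Carrier) → Carrier
  ∑from a zero    f = 0#
  ∑from a (suc m) f = f a + ∑from (suc a) m f

  conv : (ℕ → ℕ → Carrier) → ℕ → Carrier
  conv F zero    = F 0 0
  conv F (suc r) = F 0 (suc r) + conv (λ i j → F (suc i) j) r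

  module _ {a} {A : Set a} where

    ∑-cong : ∀ (xs : List A) {f g : A → Carrier} → (∀ x → f x ≈ g x) → ∑ xs f ≈ ∑ xs g
    ∑-cong []       e = refl
    ∑-cong (x ∷ xs) e = +-cong (e x) (∑-cong xs e)

    ∑-zero : ∀ (xs : List A) {f : A → Carrier} → (∀ x → f x ≈ 0#) → ∑ xs f ≈ 0#
    ∑-zero []       e = refl
    ∑-zero (x ∷ xs) e = trans (+-cong (e x) (∑-zero xs e)) (+-identityˡ 0#)

    ∑-zeroᴬ : ∀ (xs : List A) {f : A → Carrier} → All (λ x → f x ≈ 0#) xs → ∑ xs f ≈ 0#
    ∑-zeroᴬ []       []       = refl
    ∑-zeroᴬ (x ∷ xs) (e ∷ es) = trans (+-cong e (∑-zeroᴬ xs es)) (+-identityˡ 0#)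

    ∑-+ : ∀ (xs : List A) (f g : A → Carrier) → ∑ xs (λ x → f x + g x) ≈ ∑ xs f + ∑ xs g
    ∑-+ []       f g = sym (+-identityˡ 0#)
    ∑-+ (x ∷ xs) f g = trans (+-congˡ (∑-+ xs f g)) (+-interchange (f x) (g x) _ _)

    ∑-*ˡ : ∀ (xs : List A) a (f : A → Carrier) → a * ∑ xs f ≈ ∑ xs (λ x → a * f x)
    ∑-*ˡ []       a f = zeroʳ a
    ∑-*ˡ (x ∷ xs) a f = trans (distribˡ a (f x) _) (+-congˡ (∑-*ˡ xs a f))

    ∑-++ : ∀ (xs ys : List A) (f : A → Carrier) → ∑ (xs ++ ys) f ≈ ∑ xs f + ∑ ys f
    ∑-++ []       ys f = sym (+-identityˡ _)
    ∑-++ (x ∷ xs) ys f = trans (+-congˡ (∑-++ xs ys f)) (sym (+-assoc _ _ _))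

    ∑-filter : ∀ {p} {P : A → Set p} (P? : Decidable P) (xs : List A) (f : A → Carrier) →
               ∑ (filter P? xs) f ≈ ∑ xs (λ x → when (P? x) (f x))
    ∑-filter P? []       f = refl
    ∑-filter P? (x ∷ xs) f with P? x
    ... | yes _ = +-congˡ (∑-filter P? xs f)
    ... | no  _ = trans (∑-filter P? xs f) (sym (+-identityˡ _))

  module _ {a b} {A : Set a} {B : Set b} where

    ∑-map : ∀ (xs : List A) (g : A → B) (f : B → Carrier) → ∑ (map g xs) f ≈ ∑ xs (f ∘ g)
    ∑-map []       g f = refl
    ∑-map (x ∷ xs) g f = +-congˡ (∑-map xs g f)

    ∑-concatMap : ∀ (xs : List A) (g : A → List B) (f : B → Carrier) →
                  ∑ (concatMap g xs) f ≈ ∑ xs (λ x → ∑ (g x) f)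
    ∑-concatMap []       g f = refl
    ∑-concatMap (x ∷ xs) g f = trans (∑-++ (g x) (concatMap g xs) f) (+-congˡ (∑-concatMap xs g f))

    ∑-comm : ∀ (xs : List A) (ys : List B) (f : A → B → Carrier) →
             ∑ xs (λ x → ∑ ys (f x)) ≈ ∑ ys (λ y → ∑ xs (λ x → f x y))
    ∑-comm []       ys f = sym (∑-zero ys (λ _ → refl))
    ∑-comm (x ∷ xs) ys f = trans (+-congˡ (∑-comm xs ys f)) (sym (∑-+ ys (f x) _))

  module _ {p} {P : Set p} where

    when-cong : ∀ (d : Dec P) {x y} → x ≈ y → when d x ≈ when d y
    when-cong (yes _) e = e
    when-cong (no  _) e = refl

    when-congᵖ : ∀ (d : Dec P) {x y} → (P → x ≈ y) → when d x ≈ when d y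
    when-congᵖ (yes p) e = e p
    when-congᵖ (no  _) e = refl

    when-yes : ∀ (d : Dec P) x → P → when d x ≈ x
    when-yes (yes _)  x _ = refl
    when-yes (no ¬p)  x p with () ← ¬p p

    when-no : ∀ (d : Dec P) x → ¬ P → when d x ≈ 0#
    when-no (yes p) x ¬p with () ← ¬p p
    when-no (no _)  x _  = refl

    when-0# : ∀ (d : Dec P) → when d 0# ≈ 0#
    when-0# (yes _) = refl
    when-0# (no  _) = refl

    when-*ˡ : ∀ (d : Dec P) a x → a * when d x ≈ when d (a * x)
    when-*ˡ (yes _) a x = refl
    when-*ˡ (no  _) a x = zeroʳ a

    when-+ : ∀ (d : Dec P) x y → when d (x + y) ≈ when d x + when d y
    when-+ (yes _) x y = refl
    when-+ (no  _) x y = sym (+-identityˡ 0#)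

    when-∑ : ∀ {a} {A : Set a} (d : Dec P) (xs : List A) (f : A → Carrier) →
             when d (∑ xs f) ≈ ∑ xs (λ x → when d (f x))
    when-∑ (yes _) xs f = refl
    when-∑ (no  _) xs f = sym (∑-zero xs (λ _ → refl))

  module _ {p q} {P : Set p} {Q : Set q} where

    when-⇔ : ∀ (d : Dec P) (e : Dec Q) x → (P → Q) → (Q → P) → when d x ≈ when e x
    when-⇔ (yes _) (yes _) x f g = refl
    when-⇔ (yes p) (no ¬q) x f g with () ← ¬q (f p)
    when-⇔ (no ¬p) (yes q) x f g with () ← ¬p (g q)
    when-⇔ (no _)  (no _)  x f g = refl

    when-when : ∀ (d : Dec P) (e : Dec Q) x → when d (when e x) ≈ when (d ×-dec e) x
    when-when (yes _) (yes _) x = refl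
    when-when (yes _) (no  _) x = refl
    when-when (no  _) (yes _) x = refl
    when-when (no  _) (no  _) x = refl

    when-* : ∀ (d : Dec P) (e : Dec Q) x y → when d x * when e y ≈ when (d ×-dec e) (x * y)
    when-* (yes _) (yes _) x y = refl
    when-* (yes _) (no  _) x y = zeroʳ x
    when-* (no  _) (yes _) x y = zeroˡ y
    when-* (no  _) (no  _) x y = zeroˡ 0#

  ∑<-cong : ∀ B {f g} → (∀ c → f c ≈ g c) → ∑< B f ≈ ∑< B g
  ∑<-cong zero    e = refl
  ∑<-cong (suc B) e = +-cong (e 0) (∑<-cong B (e ∘ suc))

  ∑<-zero : ∀ B {f : ℕ → Carrier} → (∀ x → x ℕ.< B → f x ≈ 0#) → ∑< B f ≈ 0#
  ∑<-zero zero    e = refl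
  ∑<-zero (suc B) e =
    trans (+-cong (e 0 (ℕ.s≤s ℕ.z≤n)) (∑<-zero B (λ x l → e (suc x) (ℕ.s≤s l)))) (+-identityˡ 0#)

  ∑-applyUpTo : ∀ B (g : ℕ → ℕ) (f : ℕ → Carrier) → ∑ (applyUpTo g B) f ≈ ∑< B (f ∘ g)
  ∑-applyUpTo zero    g f = refl
  ∑-applyUpTo (suc B) g f = +-congˡ (∑-applyUpTo B (g ∘ suc) f)

  ∑-upTo : ∀ B (f : ℕ → Carrier) → ∑ (upTo B) f ≈ ∑< B f
  ∑-upTo B f = ∑-applyUpTo B (λ x → x) f

  ∑<-+ : ∀ B (f g : ℕ → Carrier) → ∑< B (λ x → f x + g x) ≈ ∑< B f + ∑< B g
  ∑<-+ zero    f g = sym (+-identityˡ 0#)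
  ∑<-+ (suc B) f g = trans (+-congˡ (∑<-+ B (f ∘ suc) (g ∘ suc))) (+-interchange (f 0) (g 0) _ _)

  ∑<-*ˡ : ∀ B a (f : ℕ → Carrier) → a * ∑< B f ≈ ∑< B (λ x → a * f x)
  ∑<-*ˡ zero    a f = zeroʳ a
  ∑<-*ˡ (suc B) a f = trans (distribˡ a _ _) (+-congˡ (∑<-*ˡ B a (f ∘ suc)))

  ∑<-suc : ∀ B (f : ℕ → Carrier) → ∑< (suc B) f ≈ ∑< B f + f B
  ∑<-suc zero    f = trans (+-identityʳ _) (sym (+-identityˡ _))
  ∑<-suc (suc B) f = trans (+-congˡ (∑<-suc B (f ∘ suc))) (sym (+-assoc _ _ _))

  ∑<-split : ∀ B D (f : ℕ → Carrier) → ∑< (B ℕ.+ D) f ≈ ∑< B f + ∑< D (λ x → f (B ℕ.+ x))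
  ∑<-split zero    D f = sym (+-identityˡ _)
  ∑<-split (suc B) D f = trans (+-congˡ (∑<-split B D (f ∘ suc))) (sym (+-assoc _ _ _))

  when-∑< : ∀ {p} {P : Set p} (d : Dec P) B (f : ℕ → Carrier) → when d (∑< B f) ≈ ∑< B (λ x → when d (f x))
  when-∑< (yes _) B f = refl
  when-∑< (no  _) B f = sym (∑<-zero B (λ _ _ → refl))

  ∑<-truncate : ∀ B w (f : ℕ → Carrier) → (∀ c → w ℕ.< c → f c ≈ 0#) → w ℕ.< B → ∑< B f ≈ ∑< (suc w) f
  ∑<-truncate B w f zero-above w<B with NP.m≤n⇒∃[o]m+o≡n w<B
  ... | d , ≡.refl = trans (∑<-split (suc w) d f)
    (trans (+-congˡ (∑<-zero d (λ x _ → zero-above (suc w ℕ.+ x) (ℕ.s≤s (NP.m≤m+n w x))))) (+-identityʳ _))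

  when-*-∑< : ∀ {p} {P : Set p} (d : Dec P) x B (f : ℕ → Carrier) →
              when d (x * ∑< B f) ≈ ∑< B (λ c → when d (x * f c))
  when-*-∑< d x B f = trans (when-cong d (∑<-*ˡ B x f)) (when-∑< d B _)

  ∑-tabulate : ∀ {X : Set} N (f : Fin N → X) (F : X → Carrier) (g : ℕ → Carrier) →
               (∀ i → F (f i) ≈ g (toℕ i)) → ∑ (tabulate f) F ≈ ∑< N g
  ∑-tabulate zero    f F g e = refl
  ∑-tabulate (suc N) f F g e = +-cong (e Fin.zero) (∑-tabulate N (f ∘ Fin.suc) F (g ∘ suc) (e ∘ Fin.suc))

  ∑<-first-multiple : ∀ p .{{_ : ℕ.NonZero p}} (f : ℕ → Carrier) → ∑< p (λ a → when (p ∣? a) (f a)) ≈ f 0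
  ∑<-first-multiple (suc p′) f = trans (+-cong (when-yes (suc p′ ∣? 0) (f 0) (divides 0 ≡.refl))
    (∑<-zero p′ (λ x x<p′ → when-no (suc p′ ∣? suc x) _ (>⇒∤ (ℕ.s≤s x<p′))))) (+-identityʳ _)

  ∑<-multiples : ∀ p .{{_ : ℕ.NonZero p}} M (f : ℕ → Carrier) →
                 ∑< (M ℕ.* p) (λ a → when (p ∣? a) (f a)) ≈ ∑< M (λ b → f (p ℕ.* b))
  ∑<-multiples p zero    f = refl
  ∑<-multiples p (suc M) f = begin
    ∑< (p ℕ.+ M ℕ.* p) g
      ≈⟨ ∑<-split p (M ℕ.* p) g ⟩
    ∑< p g + ∑< (M ℕ.* p) (λ x → g (p ℕ.+ x))
      ≈⟨ +-cong (∑<-first-multiple p f) (∑<-cong (M ℕ.* p) (λ x → when-⇔ (p ∣? (p ℕ.+ x)) (p ∣? x) _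
                                       (λ d → ∣m+n∣m⇒∣n d ∣-refl) (∣m∣n⇒∣m+n ∣-refl))) ⟩
    f 0 + ∑< (M ℕ.* p) (λ x → when (p ∣? x) (f (p ℕ.+ x)))
      ≈⟨ +-cong (reflexive (≡.cong f (≡.sym (NP.*-zeroʳ p)))) (∑<-multiples p M (λ x → f (p ℕ.+ x))) ⟩
    f (p ℕ.* 0) + ∑< M (λ b → f (p ℕ.+ p ℕ.* b))
      ≈⟨ +-congˡ (∑<-cong M (λ b → reflexive (≡.cong f (≡.sym (NP.*-suc p b))))) ⟩
    ∑< (suc M) (λ b → f (p ℕ.* b)) ∎
    where g = λ a → when (p ∣? a) (f a)

  ∑<-when-¬ : ∀ {p} {P : ℕ → Set p} (P? : Decidable P) B (f : ℕ → Carrier) →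
              ∑< B (λ a → when (¬? (P? a)) (f a)) + ∑< B (λ a → when (P? a) (f a)) ≈ ∑< B f
  ∑<-when-¬ P? B f = trans (sym (∑<-+ B _ _)) (∑<-cong B (λ a → split (P? a)))
    where
    split : ∀ {q} {Q : Set q} (d : Dec Q) {v} → when (¬? d) v + when d v ≈ v
    split (yes _) = +-identityˡ _
    split (no  _) = +-identityʳ _

  ∑from-cong : ∀ a m {f g} → (∀ q → f q ≈ g q) → ∑from a m f ≈ ∑from a m g
  ∑from-cong a zero    e = refl
  ∑from-cong a (suc m) e = +-cong (e a) (∑from-cong (suc a) m e)

  ∑from-*ˡ : ∀ a m x (f : ℕ → Carrier) → x * ∑from a m f ≈ ∑from a m (λ q → x * f q)
  ∑from-*ˡ a zero    x f = zeroʳ x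
  ∑from-*ˡ a (suc m) x f = trans (distribˡ x _ _) (+-congˡ (∑from-*ˡ (suc a) m x f))

  ∑from-zero : ∀ a m → ∑from a m (λ _ → 0#) ≈ 0#
  ∑from-zero a zero    = refl
  ∑from-zero a (suc m) = trans (+-congˡ (∑from-zero (suc a) m)) (+-identityˡ 0#)

  ∑from-+ : ∀ a m (f g : ℕ → Carrier) → ∑from a m (λ q → f q + g q) ≈ ∑from a m f + ∑from a m g
  ∑from-+ a zero    f g = sym (+-identityˡ 0#)
  ∑from-+ a (suc m) f g = trans (+-congˡ (∑from-+ (suc a) m f g)) (+-interchange (f a) (g a) _ _)

  when-∑from : ∀ {p} {P : Set p} (d : Dec P) a m (f : ℕ → Carrier) →
               when d (∑from a m f) ≈ ∑from a m (λ q → when d (f q))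
  when-∑from (yes _) a m f = refl
  when-∑from (no  _) a m f = sym (∑from-zero a m)

  when-*-∑from : ∀ {p} {P : Set p} (d : Dec P) x a m (f : ℕ → Carrier) →
                 when d (x * ∑from a m f) ≈ ∑from a m (λ q → when d (x * f q))
  when-*-∑from d x a m f = trans (when-cong d (∑from-*ˡ a m x f)) (when-∑from d a m _)

  ∑<-∑from : ∀ B a m (f : ℕ → ℕ → Carrier) →
             ∑< B (λ c → ∑from a m (f c)) ≈ ∑from a m (λ q → ∑< B (λ c → f c q))
  ∑<-∑from zero    a m f = sym (∑from-zero a m)
  ∑<-∑from (suc B) a m f = trans (+-congˡ (∑<-∑from B a m (f ∘ suc))) (sym (∑from-+ a m (f 0) _))

  ∑from≈∑< : ∀ a m (f : ℕ → Carrier) → ∑from a m f ≈ ∑< m (λ i → f (a ℕ.+ i))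
  ∑from≈∑< a zero    f = refl
  ∑from≈∑< a (suc m) f = +-cong (reflexive (≡.cong f (≡.sym (NP.+-identityʳ a))))
    (trans (∑from≈∑< (suc a) m f) (∑<-cong m (λ i → reflexive (≡.cong f (≡.sym (NP.+-suc a i))))))

  conv-cong : ∀ r {F G : ℕ → ℕ → Carrier} → (∀ i j → i ℕ.+ j ≡ r → F i j ≈ G i j) → conv F r ≈ conv G r
  conv-cong zero    e = e 0 0 ≡.refl
  conv-cong (suc r) e = +-cong (e 0 (suc r) ≡.refl) (conv-cong r (λ i j eq → e (suc i) j (≡.cong suc eq)))

  conv-*ˡ : ∀ r a (F : ℕ → ℕ → Carrier) → a * conv F r ≈ conv (λ i j → a * F i j) r
  conv-*ˡ zero    a F = refl
  conv-*ˡ (suc r) a F = trans (distribˡ a _ _) (+-congˡ (conv-*ˡ r a _))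

  conv≈∑< : ∀ r (g : ℕ → Carrier) → conv (λ i _ → g i) r ≈ ∑< (suc r) g
  conv≈∑< zero    g = sym (+-identityʳ _)
  conv≈∑< (suc r) g = +-congˡ (conv≈∑< r (g ∘ suc))

module CanonicalMaps {c ℓ : Level} (R : CommutativeRing c ℓ) where
  open CommutativeRing R
  open SetoidReasoning setoid
  open import Algebra.Properties.Ring ring using (-‿distribˡ-*; -‿involutive; -0#≈0#; -‿+-comm)
  open import Algebra.Properties.CommutativeSemigroup *-commutativeSemigroup using () renaming (interchange to *-interchange)

  nat : ℕ → Carrier
  nat = natR R

  int : ℤ → Carrier
  int = intR R

  pow : Carrier → ℕ → Carrier
  pow = powR R

  nat-+ : ∀ a b → nat (a ℕ.+ b) ≈ nat a + nat b
  nat-+ zero    b = sym (+-identityˡ _)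
  nat-+ (suc a) b = trans (+-congˡ (nat-+ a b)) (sym (+-assoc _ _ _))

  nat-* : ∀ a b → nat (a ℕ.* b) ≈ nat a * nat b
  nat-* zero    b = sym (zeroˡ _)
  nat-* (suc a) b = begin
    nat (b ℕ.+ a ℕ.* b)           ≈⟨ nat-+ b (a ℕ.* b) ⟩
    nat b + nat (a ℕ.* b)         ≈⟨ +-cong (sym (*-identityˡ _)) (nat-* a b) ⟩
    1# * nat b + nat a * nat b    ≈⟨ sym (distribʳ _ _ _) ⟩
    (1# + nat a) * nat b          ∎

  int-⊖ : ∀ a b → int (a ℤ.⊖ b) ≈ nat a - nat b
  int-⊖ zero    zero    = sym (trans (+-congˡ -0#≈0#) (+-identityʳ 0#))
  int-⊖ (suc a) zero    = sym (trans (+-congˡ -0#≈0#) (+-identityʳ _))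
  int-⊖ zero    (suc b) = sym (+-identityˡ _)
  int-⊖ (suc a) (suc b) = begin
    int (suc a ℤ.⊖ suc b)                ≡⟨ ≡.cong int (ZP.[1+m]⊖[1+n]≡m⊖n a b) ⟩
    int (a ℤ.⊖ b)                        ≈⟨ int-⊖ a b ⟩
    nat a - nat b                        ≈⟨ +-congˡ (sym (+-identityˡ _)) ⟩
    nat a + (0# + - nat b)               ≈⟨ +-congˡ (+-congʳ (sym (-‿inverseʳ 1#))) ⟩
    nat a + ((1# - 1#) + - nat b)        ≈⟨ +-congˡ (+-assoc _ _ _) ⟩
    nat a + (1# + (- 1# + - nat b))      ≈⟨ sym (+-assoc _ _ _) ⟩
    (nat a + 1#) + (- 1# + - nat b)      ≈⟨ +-cong (+-comm _ _) (-‿+-comm 1# (nat b)) ⟩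
    (1# + nat a) - (1# + nat b)          ∎

  signR : Sign → Carrier
  signR Sign.+ = 1#
  signR Sign.- = - 1#

  signR-* : ∀ s t → signR (s Sign.* t) ≈ signR s * signR t
  signR-* Sign.+ Sign.+ = sym (*-identityˡ _)
  signR-* Sign.+ Sign.- = sym (*-identityˡ _)
  signR-* Sign.- Sign.+ = sym (*-identityʳ _)
  signR-* Sign.- Sign.- =
    sym (trans (sym (-‿distribˡ-* 1# (- 1#))) (trans (-‿cong (*-identityˡ _)) (-‿involutive 1#)))

  int-◃ : ∀ s n → int (s ℤ.◃ n) ≈ signR s * nat n
  int-◃ s      zero    = sym (zeroʳ _)
  int-◃ Sign.+ (suc n) = sym (*-identityˡ _)
  int-◃ Sign.- (suc n) = trans (-‿cong (sym (*-identityˡ _))) (-‿distribˡ-* 1# _)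

  int≈sign*abs : ∀ x → int x ≈ signR (ℤ.sign x) * nat ℤ.∣ x ∣
  int≈sign*abs (+ n)    = sym (*-identityˡ _)
  int≈sign*abs -[1+ n ] = int-◃ Sign.- (suc n)

  int-* : ∀ x y → int (x ℤ.* y) ≈ int x * int y
  int-* x y = begin
    int (sx Sign.* sy ℤ.◃ ℤ.∣ x ∣ ℕ.* ℤ.∣ y ∣)                 ≈⟨ int-◃ (sx Sign.* sy) (ℤ.∣ x ∣ ℕ.* ℤ.∣ y ∣) ⟩
    signR (sx Sign.* sy) * nat (ℤ.∣ x ∣ ℕ.* ℤ.∣ y ∣)           ≈⟨ *-cong (signR-* sx sy) (nat-* ℤ.∣ x ∣ ℤ.∣ y ∣) ⟩
    (signR sx * signR sy) * (nat ℤ.∣ x ∣ * nat ℤ.∣ y ∣)        ≈⟨ *-interchange _ _ _ _ ⟩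
    (signR sx * nat ℤ.∣ x ∣) * (signR sy * nat ℤ.∣ y ∣)        ≈⟨ *-cong (sym (int≈sign*abs x)) (sym (int≈sign*abs y)) ⟩
    int x * int y                                              ∎
    where sx = ℤ.sign x; sy = ℤ.sign y

  int-+ : ∀ x y → int (x ℤ.+ y) ≈ int x + int y
  int-+ (+ m)      (+ n)      = nat-+ m n
  int-+ (+ m)      -[1+ n ]   = int-⊖ m (suc n)
  int-+ -[1+ m ]   (+ n)      = trans (int-⊖ n (suc m)) (+-comm _ _)
  int-+ -[1+ m ]   -[1+ n ]   = begin
    - nat (suc (suc (m ℕ.+ n)))    ≡⟨ ≡.cong (λ v → - nat (suc v)) (≡.sym (NP.+-suc m n)) ⟩
    - nat (suc m ℕ.+ suc n)        ≈⟨ -‿cong (nat-+ (suc m) (suc n)) ⟩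
    - (nat (suc m) + nat (suc n))  ≈⟨ sym (-‿+-comm _ _) ⟩
    - nat (suc m) + - nat (suc n)  ∎

  int-neg : ∀ x → int (ℤ.- x) ≈ - int x
  int-neg (+ zero)  = sym -0#≈0#
  int-neg (+ suc n) = refl
  int-neg -[1+ n ]  = sym (-‿involutive _)

  int-conv : ∀ r (F : ℕ → ℕ → ℤ) →
             int (RingSums.conv ZP.+-*-commutativeRing F r) ≈ RingSums.conv R (λ i j → int (F i j)) r
  int-conv zero    F = refl
  int-conv (suc r) F = trans (int-+ (F 0 (suc r)) _) (+-congˡ (int-conv r (λ i j → F (suc i) j)))

  pow-cong : ∀ {x y} n → x ≈ y → pow x n ≈ pow y n
  pow-cong zero    e = refl
  pow-cong (suc n) e = *-cong e (pow-cong n e)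

  pow-+ : ∀ x a b → pow x (a ℕ.+ b) ≈ pow x a * pow x b
  pow-+ x zero    b = sym (*-identityˡ _)
  pow-+ x (suc a) b = trans (*-congˡ (pow-+ x a b)) (sym (*-assoc _ _ _))

  pow-1# : ∀ n → pow 1# n ≈ 1#
  pow-1# zero    = refl
  pow-1# (suc n) = trans (*-identityˡ _) (pow-1# n)

  pow-* : ∀ x a b → pow x (a ℕ.* b) ≈ pow (pow x a) b
  pow-* x a zero    = reflexive (≡.cong (pow x) (NP.*-zeroʳ a))
  pow-* x a (suc b) = begin
    pow x (a ℕ.* suc b)          ≡⟨ ≡.cong (pow x) (NP.*-suc a b) ⟩
    pow x (a ℕ.+ a ℕ.* b)        ≈⟨ pow-+ x a (a ℕ.* b) ⟩
    pow x a * pow x (a ℕ.* b)    ≈⟨ *-congˡ (pow-* x a b) ⟩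
    pow x a * pow (pow x a) b    ∎

  pow-comm : ∀ x a b → pow (pow x a) b ≈ pow (pow x b) a
  pow-comm x a b = trans (sym (pow-* x a b)) (trans (reflexive (≡.cong (pow x) (NP.*-comm a b))) (pow-* x b a))

  int-^ : ∀ u k → int (u ℤ.^ k) ≈ pow (int u) k
  int-^ u zero    = +-identityʳ 1#
  int-^ u (suc k) = trans (int-* u (u ℤ.^ k)) (*-congˡ (int-^ u k))

  int-[-1]^ : ∀ k → int ((ℤ.- (+ 1)) ℤ.^ k) ≈ pow (- 1#) k
  int-[-1]^ k = trans (int-^ (ℤ.- (+ 1)) k) (pow-cong k (-‿cong (+-identityʳ 1#)))

module CycleFactors where
  open import Data.Nat using (_+_; _*_; _∸_; _^_; _≤_; _!; NonZero)
  open import Data.Nat.Properties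
  open import Data.Nat.DivMod using (_/_; *-/-assoc; /-congʳ; m*n/m*o≡n/o)
  open import Data.Nat.Divisibility
  open import Data.Nat.Combinatorics using (k![n∸k]!∣n!)
  open import Algebra.Properties.CommutativeSemigroup *-commutativeSemigroup using () renaming (interchange to *-interchange)
  open ≡.≡-Reasoning

  cycleFactor : ℕ → ℕ → ℕ
  cycleFactor j c = suc j ^ c * c !

  cycleFactor≢0 : ∀ j c → NonZero (cycleFactor j c)
  cycleFactor≢0 j c = m*n≢0 _ _ {{m^n≢0 (suc j) c}} {{c !≢0}}

  peel : ℕ → ℕ → ℕ → ℕ
  peel K j c = (K / cycleFactor j c) {{cycleFactor≢0 j c}}

  cycleFactor-suc : ∀ j c → cycleFactor j (suc c) ≡ (suc j * suc c) * cycleFactor j c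
  cycleFactor-suc j c = *-interchange (suc j) (suc j ^ c) (suc c) (c !)

  cycleFactor∣! : ∀ j c → cycleFactor j c ∣ (suc j * c) !
  cycleFactor∣! j zero    = ≡.subst (λ z → 1 ∣ z !) (≡.sym (*-zeroʳ (suc j))) (1∣ _)
  cycleFactor∣! j (suc c) = ≡.subst (_∣ (suc j * suc c) !) (≡.sym (cycleFactor-suc j c))
    (*-monoʳ-∣ (suc j * suc c) (∣-trans (cycleFactor∣! j c) (m≤n⇒m!∣n! (+-monoʳ-≤ c (*-monoʳ-≤ j (n≤1+n c))))))

  cycleFactor*!∣! : ∀ j c w → suc j * c ≤ w → cycleFactor j c * (w ∸ suc j * c) ! ∣ w !
  cycleFactor*!∣! j c w le = ∣-trans (*-monoˡ-∣ ((w ∸ suc j * c) !) (cycleFactor∣! j c)) (k![n∸k]!∣n! le)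

  cycleFactor∣ : ∀ j c w K → suc j * c ≤ w → w ! ∣ K → cycleFactor j c ∣ K
  cycleFactor∣ j c w K le d = ∣-trans (∣m⇒∣m*n _ ∣-refl) (∣-trans (cycleFactor*!∣! j c w le) d)

  !∣peel : ∀ j c w K → suc j * c ≤ w → w ! ∣ K → (w ∸ suc j * c) ! ∣ peel K j c
  !∣peel j c w K le d = m*n∣o⇒n∣o/m (cycleFactor j c) _ {{cycleFactor≢0 j c}} (∣-trans (cycleFactor*!∣! j c w le) d)

  peel-suc : ∀ j c K → cycleFactor j (suc c) ∣ K → (suc j * suc c) * peel K j (suc c) ≡ peel K j c
  peel-suc j c K d = begin
    a * peel K j (suc c)                  ≡⟨ *-/-assoc a {{nz₁}} d ⟨
    (a * K / cycleFactor j (suc c)) {{nz₁}}  ≡⟨ /-congʳ {{nz₁}} {{nz₂}} (cycleFactor-suc j c) ⟩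
    (a * K / (a * cycleFactor j c)) {{nz₂}}  ≡⟨ m*n/m*o≡n/o a K (cycleFactor j c) {{nz₀}} {{nz₂}} ⟩
    peel K j c                            ∎
    where
    a = suc j * suc c
    nz₀ = cycleFactor≢0 j c
    nz₁ = cycleFactor≢0 j (suc c)
    nz₂ = m*n≢0 a (cycleFactor j c) {{_}} {{nz₀}}

  fallingFactorial : ℕ → ℕ → ℕ
  fallingFactorial r       zero    = 1
  fallingFactorial zero    (suc i) = 0
  fallingFactorial (suc r) (suc i) = suc r * fallingFactorial r i

  fallingFactorial*! : ∀ i j → fallingFactorial (i + j) i * j ! ≡ (i + j) !
  fallingFactorial*! zero    j = +-identityʳ (j !)
  fallingFactorial*! (suc i) j =
    ≡.trans (*-assoc (suc (i + j)) (fallingFactorial (i + j) i) (j !)) (≡.cong (suc (i + j) *_) (fallingFactorial*! i j))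

module CycleIndexRecurrence (s : ℕ → ℤ) where
  open import Data.Nat using (_+_; _*_; _∸_; _≤_; _<_; _≤?_; _≟_; _!; z≤n; s≤s)
  open import Data.Nat.Properties
    using (_!≢0; ≤-refl; ≤-trans; *-assoc; ≤-<-trans; <⇒≱; n≤1+n; m≤m+n; m≤n+m; m≤m*n; m≤n*m; m∸n≤m; m+n∸m≡n;
           m+[n∸m]≡n; m+n≤o⇒m≤o; ∸-monoˡ-≤; +-monoʳ-≤; ∸-+-assoc; +-comm; +-suc; +-identityʳ; *-zeroʳ; *-suc)
  open import Data.Nat.DivMod using (_/_; n/1≡n; m/n/o≡m/[n*o]; *-/-assoc; m*n/n≡m; m/n*n≡m)
  open import Data.Nat.Divisibility using (_∣_; ∣-refl; m≤n⇒m!∣n!)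
  open import Data.Integer.Tactic.RingSolver using (solve-∀)
  open CycleFactors
  open RingSums ZP.+-*-commutativeRing
  open import Algebra.Properties.CommutativeSemigroup ZP.*-commutativeSemigroup using (x∙yz≈y∙xz)
  open ≡.≡-Reasoning

  -- Zenum K j B m w sums over exponent vectors (c_{j+1}, …, c_{j+m}) with entries below B and
  -- ∑ i c_i = w, with K in place of k!, so that Z k s is Zenum (k !) 0 (suc k) k k by definition.
  summand : ℕ → ℕ → ∀ {m} → Vec ℕ m → ℤ
  summand K j cs = + ((K / den j cs) {{den-nonZero j cs}}) ℤ.* mono s j cs

  Zenum : ℕ → ℕ → ℕ → ℕ → ℕ → ℤ
  Zenum K j B m w = ∑ (filter (λ cs → weight j cs ≟ w) (tuples (upTo B) m)) (summand K j)

  mutual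
    Zfold : ℕ → ℕ → ℕ → ℕ → ℕ → ℤ
    Zfold K j B zero    w = when (w ≟ 0) (+ K)
    Zfold K j B (suc m) w = ∑< B (Zterm K j B m w)

    Zterm : ℕ → ℕ → ℕ → ℕ → ℕ → ℕ → ℤ
    Zterm K j B m w c =
      when (suc j * c ≤? w) (s (suc j) ℤ.^ c ℤ.* Zfold (peel K j c) (suc j) B m (w ∸ suc j * c))

  +≡⇒≤×≡∸ : ∀ a x w → a + x ≡ w → a ≤ w × x ≡ w ∸ a
  +≡⇒≤×≡∸ a x w ≡.refl = m≤m+n a x , ≡.sym (m+n∸m≡n a x)

  ≤×≡∸⇒+≡ : ∀ a x w → a ≤ w × x ≡ w ∸ a → a + x ≡ w
  ≤×≡∸⇒+≡ a x w (a≤w , ≡.refl) = m+[n∸m]≡n a≤w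

  ≤×≤∸⇒+≤ : ∀ x y w → x ≤ w → y ≤ w ∸ x → x + y ≤ w
  ≤×≤∸⇒+≤ x y w x≤w y≤ = ≡.subst (x + y ≤_) (m+[n∸m]≡n x≤w) (+-monoʳ-≤ x y≤)

  +≤⇒≤×≤∸ : ∀ x y w → x + y ≤ w → x ≤ w × y ≤ w ∸ x
  +≤⇒≤×≤∸ x y w le = m+n≤o⇒m≤o x le , ≡.subst (_≤ w ∸ x) (m+n∸m≡n x y) (∸-monoˡ-≤ x le)

  summand-cons : ∀ K j c {m} (cs : Vec ℕ m) →
                 s (suc j) ℤ.^ c ℤ.* summand (peel K j c) (suc j) cs ≡ summand K j (c ∷ cs)
  summand-cons K j c cs = ≡.trans
    (≡.cong (λ q → s (suc j) ℤ.^ c ℤ.* (+ q ℤ.* mono s (suc j) cs))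
      (m/n/o≡m/[n*o] K _ _ {{cycleFactor≢0 j c}} {{den-nonZero (suc j) cs}} {{den-nonZero j (c ∷ cs)}}))
    (x∙yz≈y∙xz (s (suc j) ℤ.^ c) (+ ((K / den j (c ∷ cs)) {{den-nonZero j (c ∷ cs)}})) (mono s (suc j) cs))

  Zenum-cons : ∀ K j B m w c →
    when (suc j * c ≤? w) (s (suc j) ℤ.^ c ℤ.* Zenum (peel K j c) (suc j) B m (w ∸ suc j * c))
    ≡ ∑ (tuples (upTo B) m) (λ cs → when (weight j (c ∷ cs) ≟ w) (summand K j (c ∷ cs)))
  Zenum-cons K j B m w c = begin
    when d (a ℤ.* Zenum K′ (suc j) B m w′)
      ≡⟨ when-cong d (≡.trans (≡.cong (a ℤ.*_) (∑-filter (λ cs → weight (suc j) cs ≟ w′) T _)) (∑-*ˡ T a _)) ⟩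
    when d (∑ T (λ cs → a ℤ.* when (e cs) (summand K′ (suc j) cs)))
      ≡⟨ when-∑ d T _ ⟩
    ∑ T (λ cs → when d (a ℤ.* when (e cs) (summand K′ (suc j) cs)))
      ≡⟨ ∑-cong T (λ cs → ≡.trans (when-cong d (when-*ˡ (e cs) a _)) (when-when d (e cs) _)) ⟩
    ∑ T (λ cs → when (d ×-dec e cs) (a ℤ.* summand K′ (suc j) cs))
      ≡⟨ ∑-cong T (λ cs → ≡.trans (when-⇔ (d ×-dec e cs) (weight j (c ∷ cs) ≟ w) _
                                     (≤×≡∸⇒+≡ (suc j * c) _ w) (+≡⇒≤×≡∸ (suc j * c) _ w))
                                   (when-cong (weight j (c ∷ cs) ≟ w) (summand-cons K j c cs))) ⟩
    ∑ T (λ cs → when (weight j (c ∷ cs) ≟ w) (summand K j (c ∷ cs))) ∎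
    where
    T = tuples (upTo B) m
    a = s (suc j) ℤ.^ c
    K′ = peel K j c
    w′ = w ∸ suc j * c
    d = suc j * c ≤? w
    e = λ (cs : Vec ℕ m) → weight (suc j) cs ≟ w′

  Zenum≡Zfold : ∀ m K j B w → Zenum K j B m w ≡ Zfold K j B m w
  Zenum≡Zfold zero K j B w = begin
    Zenum K j B zero w                         ≡⟨ ∑-filter (λ cs → weight j cs ≟ w) ([] ∷ []) _ ⟩
    when (0 ≟ w) (+ (K / 1) ℤ.* + 1) ℤ.+ + 0  ≡⟨ ZP.+-identityʳ _ ⟩
    when (0 ≟ w) (+ (K / 1) ℤ.* + 1)          ≡⟨ when-cong (0 ≟ w) (≡.trans (ZP.*-identityʳ _) (≡.cong +_ (n/1≡n K))) ⟩
    when (0 ≟ w) (+ K)                         ≡⟨ when-⇔ (0 ≟ w) (w ≟ 0) (+ K) ≡.sym ≡.sym ⟩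
    when (w ≟ 0) (+ K)                         ∎
  Zenum≡Zfold (suc m) K j B w = begin
    Zenum K j B (suc m) w
      ≡⟨ ∑-filter (λ cs → weight j cs ≟ w) (concatMap (λ c → map (c ∷_) T) (upTo B)) _ ⟩
    ∑ (concatMap (λ c → map (c ∷_) T) (upTo B)) (λ cs → when (weight j cs ≟ w) (summand K j cs))
      ≡⟨ ∑-concatMap (upTo B) (λ c → map (c ∷_) T) _ ⟩
    ∑ (upTo B) (λ c → ∑ (map (c ∷_) T) (λ cs → when (weight j cs ≟ w) (summand K j cs)))
      ≡⟨ ∑-cong (upTo B) (λ c → ∑-map T (c ∷_) _) ⟩
    ∑ (upTo B) (λ c → ∑ T (λ cs → when (weight j (c ∷ cs) ≟ w) (summand K j (c ∷ cs))))
      ≡⟨ ∑-upTo B _ ⟩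
    ∑< B (λ c → ∑ T (λ cs → when (weight j (c ∷ cs) ≟ w) (summand K j (c ∷ cs))))
      ≡⟨ ∑<-cong B (λ c → ≡.sym (≡.trans (when-cong (suc j * c ≤? w) (≡.cong (s (suc j) ℤ.^ c ℤ.*_)
                                    (≡.sym (Zenum≡Zfold m (peel K j c) (suc j) B (w ∸ suc j * c)))))
                                  (Zenum-cons K j B m w c))) ⟩
    Zfold K j B (suc m) w ∎
    where T = tuples (upTo B) m

  Zfold-scale : ∀ m j K a B w → w ! ∣ K → Zfold (a * K) j B m w ≡ + a ℤ.* Zfold K j B m w
  Zfold-scale zero    j K a B w _    = ≡.trans (when-cong (w ≟ 0) (ZP.pos-* a K)) (≡.sym (when-*ˡ (w ≟ 0) (+ a) (+ K)))
  Zfold-scale (suc m) j K a B w w!∣K = ≡.trans (∑<-cong B scale-term) (≡.sym (∑<-*ˡ B (+ a) _))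
    where
    scale-term : ∀ c → Zterm (a * K) j B m w c ≡ + a ℤ.* Zterm K j B m w c
    scale-term c = ≡.trans (when-congᵖ (suc j * c ≤? w) λ le → begin
        s (suc j) ℤ.^ c ℤ.* Zfold (peel (a * K) j c) (suc j) B m w′
          ≡⟨ ≡.cong (λ K′ → s (suc j) ℤ.^ c ℤ.* Zfold K′ (suc j) B m w′)
                    (*-/-assoc a {{cycleFactor≢0 j c}} (cycleFactor∣ j c w K le w!∣K)) ⟩
        s (suc j) ℤ.^ c ℤ.* Zfold (a * peel K j c) (suc j) B m w′
          ≡⟨ ≡.cong (s (suc j) ℤ.^ c ℤ.*_) (Zfold-scale m (suc j) (peel K j c) a B w′ (!∣peel j c w K le w!∣K)) ⟩
        s (suc j) ℤ.^ c ℤ.* (+ a ℤ.* Zfold (peel K j c) (suc j) B m w′)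
          ≡⟨ x∙yz≈y∙xz (s (suc j) ℤ.^ c) (+ a) (Zfold (peel K j c) (suc j) B m w′) ⟩
        + a ℤ.* (s (suc j) ℤ.^ c ℤ.* Zfold (peel K j c) (suc j) B m w′) ∎)
      (≡.sym (when-*ˡ (suc j * c ≤? w) (+ a) _))
      where w′ = w ∸ suc j * c

  Zfold-light : ∀ m j K B w → w ≤ j → Zfold K j (suc B) m w ≡ when (w ≟ 0) (+ K)
  Zfold-light zero    j K B w w≤j = ≡.refl
  Zfold-light (suc m) j K B w w≤j = begin
    Zterm K j (suc B) m w 0 ℤ.+ ∑< B (λ c → Zterm K j (suc B) m w (suc c))
      ≡⟨ ≡.cong₂ ℤ._+_ first (∑<-zero B (λ c _ → rest c)) ⟩
    when (w ≟ 0) (+ K) ℤ.+ + 0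
      ≡⟨ ZP.+-identityʳ _ ⟩
    when (w ≟ 0) (+ K) ∎
    where
    first : Zterm K j (suc B) m w 0 ≡ when (w ≟ 0) (+ K)
    first = begin
      Zterm K j (suc B) m w 0
        ≡⟨ when-yes (suc j * 0 ≤? w) _ (≡.subst (_≤ w) (≡.sym (*-zeroʳ (suc j))) z≤n) ⟩
      + 1 ℤ.* Zfold (peel K j 0) (suc j) (suc B) m (w ∸ suc j * 0)
        ≡⟨ ZP.*-identityˡ _ ⟩
      Zfold (peel K j 0) (suc j) (suc B) m (w ∸ suc j * 0)
        ≡⟨ ≡.cong₂ (λ K′ w′ → Zfold K′ (suc j) (suc B) m w′) (n/1≡n K) (≡.cong (w ∸_) (*-zeroʳ (suc j))) ⟩
      Zfold K (suc j) (suc B) m w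
        ≡⟨ Zfold-light m (suc j) K B w (≤-trans w≤j (n≤1+n j)) ⟩
      when (w ≟ 0) (+ K) ∎
    rest : ∀ c → Zterm K j (suc B) m w (suc c) ≡ + 0
    rest c = when-no (suc j * suc c ≤? w) _ (λ le → <⇒≱ (s≤s w≤j) (≤-trans (m≤m*n (suc j) (suc c)) le))

  Zfold-length : ∀ m m′ j K B w → w ≤ j + m → w ≤ j + m′ → Zfold K j (suc B) m w ≡ Zfold K j (suc B) m′ w
  Zfold-length zero    m′       j K B w l l′ = ≡.sym (Zfold-light m′ j K B w (≡.subst (w ≤_) (+-identityʳ j) l))
  Zfold-length (suc m) zero     j K B w l l′ = Zfold-light (suc m) j K B w (≡.subst (w ≤_) (+-identityʳ j) l′)
  Zfold-length (suc m) (suc m′) j K B w l l′ = ∑<-cong (suc B) λ c → when-cong (suc j * c ≤? w)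
      (≡.cong (s (suc j) ℤ.^ c ℤ.*_) (Zfold-length m m′ (suc j) (peel K j c) B (w ∸ suc j * c) (bound c l) (bound c l′)))
    where
    bound : ∀ c {m} → w ≤ j + suc m → w ∸ suc j * c ≤ suc j + m
    bound c {m} l = ≤-trans (m∸n≤m w (suc j * c)) (≡.subst (w ≤_) (+-suc j m) l)

  Zfold-bound : ∀ m j K B B′ w → w < B → w < B′ → Zfold K j B m w ≡ Zfold K j B′ m w
  Zfold-bound zero    j K B B′ w l l′ = ≡.refl
  Zfold-bound (suc m) j K B B′ w l l′ = begin
    ∑< B (Zterm K j B m w)   ≡⟨ ∑<-cong B (λ c → when-cong (suc j * c ≤? w) (≡.cong (s (suc j) ℤ.^ c ℤ.*_) (ih c))) ⟩
    ∑< B (Zterm K j B′ m w)  ≡⟨ ∑<-truncate B w _ vanish l ⟩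
    ∑< (suc w) (Zterm K j B′ m w) ≡⟨ ∑<-truncate B′ w _ vanish l′ ⟨
    ∑< B′ (Zterm K j B′ m w) ∎
    where
    ih : ∀ c → Zfold (peel K j c) (suc j) B m (w ∸ suc j * c) ≡ Zfold (peel K j c) (suc j) B′ m (w ∸ suc j * c)
    ih c = Zfold-bound m (suc j) (peel K j c) B B′ (w ∸ suc j * c)
             (≤-<-trans (m∸n≤m w (suc j * c)) l) (≤-<-trans (m∸n≤m w (suc j * c)) l′)
    vanish : ∀ c → w < c → Zterm K j B′ m w c ≡ + 0
    vanish c w<c = when-no (suc j * c ≤? w) _ (λ le → <⇒≱ w<c (≤-trans (m≤n*m c (suc j)) le))

  ∸-∸-comm : ∀ w x y → w ∸ x ∸ y ≡ w ∸ y ∸ x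
  ∸-∸-comm w x y = ≡.trans (∸-+-assoc w x y) (≡.trans (≡.cong (w ∸_) (+-comm x y)) (≡.sym (∸-+-assoc w y x)))

  ≤×≤∸-swap : ∀ {x y w} → x ≤ w × y ≤ w ∸ x → y ≤ w × x ≤ w ∸ y
  ≤×≤∸-swap {x} {y} {w} (x≤w , y≤) = +≤⇒≤×≤∸ y x w (≡.subst (_≤ w) (+-comm x y) (≤×≤∸⇒+≤ x y w x≤w y≤))

  -- Split w = i c + (w ∸ i c) in each term: the part i c lowers c by one (peel-suc) and gives the
  -- q = i term; the part w ∸ i c is the same recurrence for (c_{i+1}, …), by induction.
  module WeightStep (m j K B₀ w : ℕ) (w!∣K : w ! ∣ K) (w<B : w < suc B₀) where
    B i : ℕ
    B = suc B₀
    i = suc j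

    Y : ℕ → ℕ → ℤ
    Y c = Zfold (peel K j c) i B m

    weighted : ℕ → ℕ → ℤ
    weighted c n = when (i * c ≤? w) (s i ℤ.^ c ℤ.* (+ n ℤ.* Y c (w ∸ i * c)))

    recTerm : ℕ → ℤ
    recTerm q = when (q ≤? w) (s q ℤ.* Zfold K j B (suc m) (w ∸ q))

    recTerm≡∑< : ∀ q → recTerm q ≡ ∑< B (λ c → when (q ≤? w) (s q ℤ.* Zterm K j B m (w ∸ q) c))
    recTerm≡∑< q = when-*-∑< (q ≤? w) (s q) B (Zterm K j B m (w ∸ q))

    split : ∀ c → + w ℤ.* Zterm K j B m w c ≡ weighted c (i * c) ℤ.+ weighted c (w ∸ i * c)
    split c = ≡.trans (when-*ˡ (i * c ≤? w) (+ w) _) (≡.trans (when-congᵖ (i * c ≤? w) (λ le → begin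
        + w ℤ.* (a ℤ.* y)                               ≡⟨ ≡.cong (λ v → + v ℤ.* (a ℤ.* y)) (m+[n∸m]≡n le) ⟨
        + (i * c + (w ∸ i * c)) ℤ.* (a ℤ.* y)           ≡⟨ ≡.cong (ℤ._* (a ℤ.* y)) (ZP.pos-+ (i * c) (w ∸ i * c)) ⟩
        (+ (i * c) ℤ.+ + (w ∸ i * c)) ℤ.* (a ℤ.* y)     ≡⟨ distrib (+ (i * c)) (+ (w ∸ i * c)) a y ⟩
        a ℤ.* (+ (i * c) ℤ.* y) ℤ.+ a ℤ.* (+ (w ∸ i * c) ℤ.* y) ∎))
      (when-+ (i * c ≤? w) _ _))
      where
      a = s i ℤ.^ c
      y = Y c (w ∸ i * c)
      distrib : ∀ x y a z → (x ℤ.+ y) ℤ.* (a ℤ.* z) ≡ a ℤ.* (x ℤ.* z) ℤ.+ a ℤ.* (y ℤ.* z)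
      distrib = solve-∀

    shifted : ℕ → ℤ
    shifted c = when (i ≤? w) (s i ℤ.* Zterm K j B m (w ∸ i) c)

    weighted-cycles-suc : ∀ c → weighted (suc c) (i * suc c) ≡ shifted c
    weighted-cycles-suc c = begin
      weighted (suc c) (i * suc c)
        ≡⟨ when-congᵖ (i * suc c ≤? w) shift ⟩
      when (i * suc c ≤? w) (s i ℤ.* (s i ℤ.^ c ℤ.* Y c (w ∸ i ∸ i * c)))
        ≡⟨ when-⇔ (i * suc c ≤? w) ((i ≤? w) ×-dec (i * c ≤? w ∸ i)) _
             (λ le → +≤⇒≤×≤∸ i (i * c) w (≡.subst (_≤ w) (*-suc i c) le))
             (λ (u , v) → ≡.subst (_≤ w) (≡.sym (*-suc i c)) (≤×≤∸⇒+≤ i (i * c) w u v)) ⟩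
      when ((i ≤? w) ×-dec (i * c ≤? w ∸ i)) (s i ℤ.* (s i ℤ.^ c ℤ.* Y c (w ∸ i ∸ i * c)))
        ≡⟨ when-when (i ≤? w) (i * c ≤? w ∸ i) _ ⟨
      when (i ≤? w) (when (i * c ≤? w ∸ i) (s i ℤ.* (s i ℤ.^ c ℤ.* Y c (w ∸ i ∸ i * c))))
        ≡⟨ when-cong (i ≤? w) (when-*ˡ (i * c ≤? w ∸ i) (s i) _) ⟨
      shifted c ∎
      where
      shift : i * suc c ≤ w → s i ℤ.^ suc c ℤ.* (+ (i * suc c) ℤ.* Y (suc c) (w ∸ i * suc c))
                            ≡ s i ℤ.* (s i ℤ.^ c ℤ.* Y c (w ∸ i ∸ i * c))
      shift le = begin
        s i ℤ.^ suc c ℤ.* (+ (i * suc c) ℤ.* Y (suc c) (w ∸ i * suc c))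
          ≡⟨ ≡.cong (s i ℤ.^ suc c ℤ.*_) (Zfold-scale m i (peel K j (suc c)) (i * suc c) B _ (!∣peel j (suc c) w K le w!∣K)) ⟨
        s i ℤ.^ suc c ℤ.* Zfold (i * suc c * peel K j (suc c)) i B m (w ∸ i * suc c)
          ≡⟨ ≡.cong₂ (λ K′ w′ → s i ℤ.^ suc c ℤ.* Zfold K′ i B m w′) (peel-suc j c K (cycleFactor∣ j (suc c) w K le w!∣K))
                     (≡.trans (≡.cong (w ∸_) (*-suc i c)) (≡.sym (∸-+-assoc w i (i * c)))) ⟩
        s i ℤ.^ suc c ℤ.* Y c (w ∸ i ∸ i * c)
          ≡⟨ ZP.*-assoc (s i) (s i ℤ.^ c) _ ⟩
        s i ℤ.* (s i ℤ.^ c ℤ.* Y c (w ∸ i ∸ i * c)) ∎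

    shifted-last : shifted B₀ ≡ + 0
    shifted-last = ≡.trans (when-congᵖ (i ≤? w) (λ i≤w →
        ≡.trans (≡.cong (s i ℤ.*_) (when-no (i * B₀ ≤? w ∸ i) _ (λ le →
          <⇒≱ w<B (≤-trans (m≤n*m B (suc j)) (≡.subst (_≤ w) (≡.sym (*-suc i B₀)) (≤×≤∸⇒+≤ i (i * B₀) w i≤w le))))))
        (ZP.*-zeroʳ (s i))))
      (when-0# (i ≤? w))

    cycles-sum : ∑< B (λ c → weighted c (i * c)) ≡ recTerm i
    cycles-sum = begin
      weighted 0 (i * 0) ℤ.+ ∑< B₀ (λ c → weighted (suc c) (i * suc c))
        ≡⟨ ≡.cong₂ ℤ._+_ first (∑<-cong B₀ weighted-cycles-suc) ⟩
      + 0 ℤ.+ ∑< B₀ shifted                 ≡⟨ ZP.+-identityˡ _ ⟩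
      ∑< B₀ shifted                         ≡⟨ ZP.+-identityʳ _ ⟨
      ∑< B₀ shifted ℤ.+ + 0                 ≡⟨ ≡.cong (λ v → ∑< B₀ shifted ℤ.+ v) shifted-last ⟨
      ∑< B₀ shifted ℤ.+ shifted B₀                ≡⟨ ∑<-suc B₀ shifted ⟨
      ∑< B shifted                          ≡⟨ recTerm≡∑< i ⟨
      recTerm i ∎
      where
      first : weighted 0 (i * 0) ≡ + 0
      first = ≡.trans (when-cong (i * 0 ≤? w)
                (≡.trans (≡.cong (λ v → + 1 ℤ.* (+ v ℤ.* Y 0 (w ∸ i * 0))) (*-zeroʳ i)) ≡.refl))
              (when-0# (i * 0 ≤? w))

    rest-sum : (∀ c → i * c ≤ w → + (w ∸ i * c) ℤ.* Y c (w ∸ i * c)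
                 ≡ ∑from (suc i) m (λ q → when (q ≤? w ∸ i * c) (s q ℤ.* Y c (w ∸ i * c ∸ q)))) →
               ∑< B (λ c → weighted c (w ∸ i * c)) ≡ ∑from (suc i) m recTerm
    rest-sum ih = begin
      ∑< B (λ c → weighted c (w ∸ i * c))
        ≡⟨ ∑<-cong B (λ c → when-congᵖ (i * c ≤? w) (λ le → ≡.cong (s i ℤ.^ c ℤ.*_) (ih c le))) ⟩
      ∑< B (λ c → when (i * c ≤? w) (s i ℤ.^ c ℤ.* ∑from (suc i) m (λ q → when (q ≤? w ∸ i * c) (s q ℤ.* Y c (w ∸ i * c ∸ q)))))
        ≡⟨ ∑<-cong B (λ c → ≡.trans (when-*-∑from (i * c ≤? w) (s i ℤ.^ c) (suc i) m (λ q → when (q ≤? w ∸ i * c) (s q ℤ.* Y c (w ∸ i * c ∸ q))))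
                                    (∑from-cong (suc i) m (λ q → when-cong (i * c ≤? w) (when-*ˡ (q ≤? w ∸ i * c) (s i ℤ.^ c) (s q ℤ.* Y c (w ∸ i * c ∸ q)))))) ⟩
      ∑< B (λ c → ∑from (suc i) m (g c))
        ≡⟨ ∑<-∑from B (suc i) m g ⟩
      ∑from (suc i) m (λ q → ∑< B (λ c → g c q))
        ≡⟨ ∑from-cong (suc i) m (λ q → ≡.trans (∑<-cong B (λ c → g-swap c q)) (≡.sym (recTerm≡∑< q))) ⟩
      ∑from (suc i) m recTerm ∎
      where
      g : ℕ → ℕ → ℤ
      g c q = when (i * c ≤? w) (when (q ≤? w ∸ i * c) (s i ℤ.^ c ℤ.* (s q ℤ.* Y c (w ∸ i * c ∸ q))))
      g-swap : ∀ c q → g c q ≡ when (q ≤? w) (s q ℤ.* Zterm K j B m (w ∸ q) c)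
      g-swap c q = begin
        g c q
          ≡⟨ when-when (i * c ≤? w) (q ≤? w ∸ i * c) _ ⟩
        when ((i * c ≤? w) ×-dec (q ≤? w ∸ i * c)) (s i ℤ.^ c ℤ.* (s q ℤ.* Y c (w ∸ i * c ∸ q)))
          ≡⟨ when-⇔ ((i * c ≤? w) ×-dec (q ≤? w ∸ i * c)) ((q ≤? w) ×-dec (i * c ≤? w ∸ q)) _ ≤×≤∸-swap ≤×≤∸-swap ⟩
        when ((q ≤? w) ×-dec (i * c ≤? w ∸ q)) (s i ℤ.^ c ℤ.* (s q ℤ.* Y c (w ∸ i * c ∸ q)))
          ≡⟨ when-cong ((q ≤? w) ×-dec (i * c ≤? w ∸ q))
               (≡.trans (≡.cong (λ v → s i ℤ.^ c ℤ.* (s q ℤ.* Y c v)) (∸-∸-comm w (i * c) q))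
                        (x∙yz≈y∙xz (s i ℤ.^ c) (s q) (Y c (w ∸ q ∸ i * c)))) ⟩
        when ((q ≤? w) ×-dec (i * c ≤? w ∸ q)) (s q ℤ.* (s i ℤ.^ c ℤ.* Y c (w ∸ q ∸ i * c)))
          ≡⟨ when-when (q ≤? w) (i * c ≤? w ∸ q) _ ⟨
        when (q ≤? w) (when (i * c ≤? w ∸ q) (s q ℤ.* (s i ℤ.^ c ℤ.* Y c (w ∸ q ∸ i * c))))
          ≡⟨ when-cong (q ≤? w) (when-*ˡ (i * c ≤? w ∸ q) (s q) _) ⟨
        when (q ≤? w) (s q ℤ.* Zterm K j B m (w ∸ q) c) ∎

  Zfold-weight : ∀ m j K B w → w ! ∣ K → w < B →
                 + w ℤ.* Zfold K j B m w ≡ ∑from (suc j) m (λ q → when (q ≤? w) (s q ℤ.* Zfold K j B m (w ∸ q)))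
  Zfold-weight zero j K B w _ _ with w ≟ 0
  ... | yes ≡.refl = ≡.refl
  ... | no  _      = ZP.*-zeroʳ (+ w)
  Zfold-weight (suc m) j K (suc B₀) w w!∣K w<B = begin
    + w ℤ.* ∑< B (Zterm K j B m w)
      ≡⟨ ∑<-*ˡ B (+ w) (Zterm K j B m w) ⟩
    ∑< B (λ c → + w ℤ.* Zterm K j B m w c)
      ≡⟨ ∑<-cong B split ⟩
    ∑< B (λ c → weighted c (i * c) ℤ.+ weighted c (w ∸ i * c))
      ≡⟨ ∑<-+ B (λ c → weighted c (i * c)) (λ c → weighted c (w ∸ i * c)) ⟩
    ∑< B (λ c → weighted c (i * c)) ℤ.+ ∑< B (λ c → weighted c (w ∸ i * c))
      ≡⟨ ≡.cong₂ ℤ._+_ cycles-sum (rest-sum (λ c le →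
           Zfold-weight m i (peel K j c) B (w ∸ i * c) (!∣peel j c w K le w!∣K) (≤-<-trans (m∸n≤m w (i * c)) w<B))) ⟩
    recTerm i ℤ.+ ∑from (suc i) m recTerm ∎
    where open WeightStep m j K B₀ w w!∣K w<B

  Zfold-factorial : ∀ k w → w ≤ k → Zfold (k !) 0 (suc k) k w ≡ + ((k ! / w !) {{w !≢0}}) ℤ.* Z w s
  Zfold-factorial k w w≤k = begin
    Zfold (k !) 0 (suc k) k w        ≡⟨ ≡.cong (λ K → Zfold K 0 (suc k) k w) (m/n*n≡m {{w !≢0}} (m≤n⇒m!∣n! w≤k)) ⟨
    Zfold (q * w !) 0 (suc k) k w    ≡⟨ Zfold-scale k 0 (w !) q (suc k) w ∣-refl ⟩
    + q ℤ.* Zfold (w !) 0 (suc k) k w  ≡⟨ ≡.cong (+ q ℤ.*_) (Zfold-bound k 0 (w !) (suc k) (suc w) w (s≤s w≤k) (s≤s ≤-refl)) ⟩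
    + q ℤ.* Zfold (w !) 0 (suc w) k w  ≡⟨ ≡.cong (+ q ℤ.*_) (Zfold-length k w 0 (w !) w w w≤k ≤-refl) ⟩
    + q ℤ.* Zfold (w !) 0 (suc w) w w  ≡⟨ ≡.cong (+ q ℤ.*_) (Zenum≡Zfold w (w !) 0 (suc w) w) ⟨
    + q ℤ.* Z w s ∎
    where q = (k ! / w !) {{w !≢0}}

  !/!≡*fallingFactorial : ∀ i j → ((suc (i + j)) ! / j !) {{j !≢0}} ≡ suc (i + j) * fallingFactorial (i + j) i
  !/!≡*fallingFactorial i j = begin
    (k * (i + j) ! / j !) {{j !≢0}}                          ≡⟨ ≡.cong (λ v → (k * v / j !) {{j !≢0}}) (fallingFactorial*! i j) ⟨
    (k * (fallingFactorial (i + j) i * j !) / j !) {{j !≢0}}  ≡⟨ ≡.cong (λ v → (v / j !) {{j !≢0}}) (*-assoc k (fallingFactorial (i + j) i) (j !)) ⟨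
    (k * fallingFactorial (i + j) i * j ! / j !) {{j !≢0}}    ≡⟨ m*n/n≡m (k * fallingFactorial (i + j) i) (j !) {{j !≢0}} ⟩
    k * fallingFactorial (i + j) i                            ∎
    where k = suc (i + j)

  Z-suc : ∀ r → Z (suc r) s ≡ conv (λ i j → + fallingFactorial (i + j) i ℤ.* (s (suc i) ℤ.* Z j s)) r
  Z-suc r = ZP.*-cancelˡ-≡ (+ k) (Z k s) _ (begin
    + k ℤ.* Z k s                        ≡⟨ ≡.cong (+ k ℤ.*_) (Zenum≡Zfold k (k !) 0 (suc k) k) ⟩
    + k ℤ.* Zfold (k !) 0 (suc k) k k    ≡⟨ Zfold-weight k 0 (k !) (suc k) k ∣-refl ≤-refl ⟩
    ∑from 1 k g                          ≡⟨ ∑from≈∑< 1 k g ⟩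
    ∑< k (λ i → g (suc i))               ≡⟨ conv≈∑< r (λ i → g (suc i)) ⟨
    conv (λ i _ → g (suc i)) r           ≡⟨ conv-cong r term ⟩
    conv (λ i j → + k ℤ.* F i j) r       ≡⟨ conv-*ˡ r (+ k) F ⟨
    + k ℤ.* conv F r                     ∎)
    where
    k = suc r
    g = λ q → when (q ≤? k) (s q ℤ.* Zfold (k !) 0 (suc k) k (k ∸ q))
    F = λ i j → + fallingFactorial (i + j) i ℤ.* (s (suc i) ℤ.* Z j s)
    reassoc : ∀ a b c d → a ℤ.* ((b ℤ.* c) ℤ.* d) ≡ b ℤ.* (c ℤ.* (a ℤ.* d))
    reassoc = solve-∀
    term : ∀ i j → i + j ≡ r → g (suc i) ≡ + k ℤ.* F i j
    term i j ≡.refl = begin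
      g (suc i)
        ≡⟨ when-yes (suc i ≤? k) _ (s≤s (m≤m+n i j)) ⟩
      s (suc i) ℤ.* Zfold (k !) 0 (suc k) k (i + j ∸ i)
        ≡⟨ ≡.cong (λ v → s (suc i) ℤ.* Zfold (k !) 0 (suc k) k v) (m+n∸m≡n i j) ⟩
      s (suc i) ℤ.* Zfold (k !) 0 (suc k) k j
        ≡⟨ ≡.cong (s (suc i) ℤ.*_) (Zfold-factorial k j (≤-trans (m≤n+m j i) (n≤1+n (i + j)))) ⟩
      s (suc i) ℤ.* (+ ((k ! / j !) {{j !≢0}}) ℤ.* Z j s)
        ≡⟨ ≡.cong (λ v → s (suc i) ℤ.* (v ℤ.* Z j s)) (≡.trans (≡.cong +_ (!/!≡*fallingFactorial i j)) (ZP.pos-* k _)) ⟩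
      s (suc i) ℤ.* ((+ k ℤ.* + fallingFactorial (i + j) i) ℤ.* Z j s)
        ≡⟨ reassoc (s (suc i)) (+ k) (+ fallingFactorial (i + j) i) (Z j s) ⟩
      + k ℤ.* F i j ∎

module DistinctSums {c ℓ : Level} (R : CommutativeRing c ℓ) {A : Set} (_≟_ : DecidableEquality A)
                    (U : List A) (U-unique : Unique U) (U-complete : ∀ x → x ∈ₚ U) where
  open CommutativeRing R
  open SetoidReasoning setoid
  open RingSums R
  open import Algebra.Properties.CommutativeSemigroup *-commutativeSemigroup using (x∙yz≈y∙xz)
  open import Algebra.Properties.CommutativeSemigroup +-commutativeSemigroup using () renaming (x∙yz≈xz∙y to x+yz≈xz+y)
  open import Data.List.Membership.DecPropositional _≟_ using (_∈_; _∈?_)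

  _∉?_ : (x : A) (ex : List A) → Dec (¬ x ∈ ex)
  x ∉? ex = ¬? (x ∈? ex)

  headSum : List A → (A → Carrier) → (A → Carrier) → Carrier
  headSum ex h F = ∑ U (λ y → when (y ∉? ex) (h y * F y))

  -- distinctSum ex (g₁ ∷ … ∷ g_m) is the sum of ∏ gᵢ(xᵢ) over pairwise distinct x₁, …, x_m ∉ ex.
  distinctSum : List A → List (A → Carrier) → Carrier
  distinctSum ex []       = 1#
  distinctSum ex (g ∷ gs) = headSum ex g (λ y → distinctSum (y ∷ ex) gs)

  sumAvoiding : List A → (A → Carrier) → Carrier
  sumAvoiding ex g = ∑ U (λ x → when (x ∉? ex) (g x))

  headSum-congᵖ : ∀ ex h {F G} → (∀ y → ¬ y ∈ ex → F y ≈ G y) → headSum ex h F ≈ headSum ex h G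
  headSum-congᵖ ex h e = ∑-cong U (λ y → when-congᵖ (y ∉? ex) (λ y∉ex → *-congˡ (e y y∉ex)))

  headSum-+ : ∀ ex h F G → headSum ex h (λ y → F y + G y) ≈ headSum ex h F + headSum ex h G
  headSum-+ ex h F G = trans (∑-cong U (λ y → trans (when-cong (y ∉? ex) (distribˡ (h y) _ _)) (when-+ (y ∉? ex) _ _)))
                             (∑-+ U _ _)

  headSum-*ˡ : ∀ ex h a F → headSum ex h (λ y → a * F y) ≈ a * headSum ex h F
  headSum-*ˡ ex h a F = trans (∑-cong U (λ y → trans (when-cong (y ∉? ex) (x∙yz≈y∙xz (h y) a (F y)))
                                                     (sym (when-*ˡ (y ∉? ex) a _))))
                              (sym (∑-*ˡ U a _))

  ∑-headSum : ∀ {b} {B : Set b} (L : List B) ex h (F : B → A → Carrier) →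
              ∑ L (λ l → headSum ex h (F l)) ≈ headSum ex h (λ y → ∑ L (λ l → F l y))
  ∑-headSum L ex h F = trans (∑-comm L U _) (∑-cong U (λ y →
    sym (trans (when-cong (y ∉? ex) (∑-*ˡ L (h y) _)) (when-∑ (y ∉? ex) L _))))

  ∑-indicator : ∀ L → Unique L → ∀ y (f : A → Carrier) → y ∈ₚ L → ∑ L (λ x → when (x ≟ y) (f x)) ≈ f y
  ∑-indicator (u ∷ L) (u∉L ∷ L-unique) y f (here ≡.refl) =
    trans (+-cong (when-yes (y ≟ y) _ ≡.refl) (∑-zeroᴬ L (All.map (λ y≢x → when-no (_ ≟ y) _ (λ x≡y → y≢x (≡.sym x≡y))) u∉L)))
          (+-identityʳ _)
  ∑-indicator (u ∷ L) (u∉L ∷ L-unique) y f (there y∈L) =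
    trans (+-cong (when-no (u ≟ y) _ (All.lookup u∉L y∈L)) (∑-indicator L L-unique y f y∈L)) (+-identityˡ _)

  sumAvoiding-∷ : ∀ ex y g → ¬ y ∈ ex → sumAvoiding (y ∷ ex) g + g y ≈ sumAvoiding ex g
  sumAvoiding-∷ ex y g y∉ex = begin
    sumAvoiding (y ∷ ex) g + g y                               ≈⟨ +-congˡ (∑-indicator U U-unique y g (U-complete y)) ⟨
    sumAvoiding (y ∷ ex) g + ∑ U (λ x → when (x ≟ y) (g x))   ≈⟨ ∑-+ U _ _ ⟨
    ∑ U (λ x → when (x ∉? (y ∷ ex)) (g x) + when (x ≟ y) (g x)) ≈⟨ ∑-cong U (λ x → split x (x ≟ y)) ⟩
    sumAvoiding ex g                                           ∎
    where
    split : ∀ x (d : Dec (x ≡ y)) → when (x ∉? (y ∷ ex)) (g x) + when d (g x) ≈ when (x ∉? ex) (g x)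
    split x (yes ≡.refl) = trans (+-congʳ (when-no (x ∉? (x ∷ ex)) _ (λ x∉ → x∉ (here ≡.refl))))
                             (trans (+-identityˡ _) (sym (when-yes (x ∉? ex) _ y∉ex)))
    split x (no x≢y)     = trans (+-identityʳ _) (when-⇔ (x ∉? (y ∷ ex)) (x ∉? ex) _
                             (λ x∉ x∈ → x∉ (there x∈))
                             (λ { x∉ (here x≡y) → x≢y x≡y ; x∉ (there x∈) → x∉ x∈ }))

  distinctSum-cong-avoid : ∀ gs ex ex′ → (∀ {z} → z ∈ ex → z ∈ ex′) → (∀ {z} → z ∈ ex′ → z ∈ ex) →
                           distinctSum ex gs ≈ distinctSum ex′ gs
  distinctSum-cong-avoid []       ex ex′ f f′ = refl
  distinctSum-cong-avoid (g ∷ gs) ex ex′ f f′ = ∑-cong U (λ x →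
    trans (when-⇔ (x ∉? ex) (x ∉? ex′) _ (λ x∉ x∈ → x∉ (f′ x∈)) (λ x∉ x∈ → x∉ (f x∈)))
          (when-cong (x ∉? ex′) (*-congˡ (distinctSum-cong-avoid gs (x ∷ ex) (x ∷ ex′) (extend f) (extend f′)))))
    where
    extend : ∀ {x ex ex′} → (∀ {z} → z ∈ ex → z ∈ ex′) → ∀ {z} → z ∈ x ∷ ex → z ∈ x ∷ ex′
    extend h (here e)  = here e
    extend h (there m) = there (h m)

  distinctSum-cong-head : ∀ gs ex {g g′ : A → Carrier} → (∀ x → g x ≈ g′ x) →
                          distinctSum ex (g ∷ gs) ≈ distinctSum ex (g′ ∷ gs)
  distinctSum-cong-head gs ex e = ∑-cong U (λ x → when-cong (x ∉? ex) (*-congʳ (e x)))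

  distinctSum-∷∷ : ∀ g h gs ex → distinctSum ex (g ∷ h ∷ gs) ≈
    ∑ U (λ x → ∑ U (λ y → when (x ∉? ex ×-dec y ∉? (x ∷ ex)) (g x * (h y * distinctSum (y ∷ x ∷ ex) gs))))
  distinctSum-∷∷ g h gs ex = ∑-cong U (λ x → begin
    when (x ∉? ex) (g x * ∑ U (λ y → when (y ∉? (x ∷ ex)) (h y * distinctSum (y ∷ x ∷ ex) gs)))
      ≈⟨ when-cong (x ∉? ex) (∑-*ˡ U (g x) _) ⟩
    when (x ∉? ex) (∑ U (λ y → g x * when (y ∉? (x ∷ ex)) (h y * distinctSum (y ∷ x ∷ ex) gs)))
      ≈⟨ when-∑ (x ∉? ex) U _ ⟩
    ∑ U (λ y → when (x ∉? ex) (g x * when (y ∉? (x ∷ ex)) (h y * distinctSum (y ∷ x ∷ ex) gs)))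
      ≈⟨ ∑-cong U (λ y → trans (when-cong (x ∉? ex) (when-*ˡ (y ∉? (x ∷ ex)) (g x) _)) (when-when (x ∉? ex) (y ∉? (x ∷ ex)) _)) ⟩
    ∑ U (λ y → when (x ∉? ex ×-dec y ∉? (x ∷ ex)) (g x * (h y * distinctSum (y ∷ x ∷ ex) gs))) ∎)

  distinctSum-swap : ∀ g h gs ex → distinctSum ex (g ∷ h ∷ gs) ≈ distinctSum ex (h ∷ g ∷ gs)
  distinctSum-swap g h gs ex = begin
    distinctSum ex (g ∷ h ∷ gs)
      ≈⟨ distinctSum-∷∷ g h gs ex ⟩
    ∑ U (λ x → ∑ U (λ y → when (x ∉? ex ×-dec y ∉? (x ∷ ex)) (g x * (h y * distinctSum (y ∷ x ∷ ex) gs))))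
      ≈⟨ ∑-comm U U _ ⟩
    ∑ U (λ y → ∑ U (λ x → when (x ∉? ex ×-dec y ∉? (x ∷ ex)) (g x * (h y * distinctSum (y ∷ x ∷ ex) gs))))
      ≈⟨ ∑-cong U (λ y → ∑-cong U (λ x →
           trans (when-⇔ (x ∉? ex ×-dec y ∉? (x ∷ ex)) (y ∉? ex ×-dec x ∉? (y ∷ ex)) _ fresh-swap fresh-swap)
                 (when-cong (y ∉? ex ×-dec x ∉? (y ∷ ex))
                   (trans (x∙yz≈y∙xz (g x) (h y) _)
                          (*-congˡ (*-congˡ (distinctSum-cong-avoid gs (y ∷ x ∷ ex) (x ∷ y ∷ ex) ∈-swap ∈-swap))))))) ⟩
    ∑ U (λ y → ∑ U (λ x → when (y ∉? ex ×-dec x ∉? (y ∷ ex)) (h y * (g x * distinctSum (x ∷ y ∷ ex) gs))))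
      ≈⟨ distinctSum-∷∷ h g gs ex ⟨
    distinctSum ex (h ∷ g ∷ gs) ∎
    where
    ∈-swap : ∀ {x y ex z} → z ∈ x ∷ y ∷ ex → z ∈ y ∷ x ∷ ex
    ∈-swap (here e)          = there (here e)
    ∈-swap (there (here e))  = here e
    ∈-swap (there (there m)) = there (there m)
    fresh-swap : ∀ {x y ex} → ¬ x ∈ ex × ¬ y ∈ x ∷ ex → ¬ y ∈ ex × ¬ x ∈ y ∷ ex
    fresh-swap (x∉ , y∉) = (λ y∈ → y∉ (there y∈)) , λ { (here ≡.refl) → y∉ (here ≡.refl) ; (there x∈) → x∉ x∈ }

  merges : (A → Carrier) → List (A → Carrier) → List (List (A → Carrier))
  merges g []       = []
  merges g (h ∷ hs) = ((λ x → g x * h x) ∷ hs) ∷ map (h ∷_) (merges g hs)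

  -- Letting g's point range over all of U ∖ ex also counts the tuples where it meets the point of
  -- some later factor h; those are the terms of the list in which g is merged into h.
  distinctSum-merge : ∀ gs ex g →
    distinctSum ex (g ∷ gs) + ∑ (merges g gs) (distinctSum ex) ≈ sumAvoiding ex g * distinctSum ex gs
  distinctSum-merge [] ex g =
    trans (+-identityʳ _) (trans (∑-cong U (λ x → when-cong (x ∉? ex) (*-identityʳ _))) (sym (*-identityʳ _)))
  distinctSum-merge (h ∷ hs) ex g = begin
    D ex (g ∷ h ∷ hs) + (D ex (gh ∷ hs) + ∑ (map (h ∷_) M) (D ex))
      ≈⟨ +-cong (distinctSum-swap g h hs ex) (+-congˡ (∑-map M (h ∷_) (D ex))) ⟩
    D ex (h ∷ g ∷ hs) + (D ex (gh ∷ hs) + ∑ M (λ l → D ex (h ∷ l)))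
      ≈⟨ x+yz≈xz+y _ _ _ ⟩
    (D ex (h ∷ g ∷ hs) + ∑ M (λ l → D ex (h ∷ l))) + D ex (gh ∷ hs)
      ≈⟨ +-cong (+-congˡ (∑-headSum M ex h (λ l y → D (y ∷ ex) l))) gh-head ⟩
    (headSum ex h (λ y → D (y ∷ ex) (g ∷ hs)) + headSum ex h (λ y → ∑ M (D (y ∷ ex)))) + headSum ex h (λ y → g y * D (y ∷ ex) hs)
      ≈⟨ +-congʳ (trans (sym (headSum-+ ex h _ _)) (headSum-congᵖ ex h (λ y _ → distinctSum-merge hs (y ∷ ex) g))) ⟩
    headSum ex h (λ y → sumAvoiding (y ∷ ex) g * D (y ∷ ex) hs) + headSum ex h (λ y → g y * D (y ∷ ex) hs)
      ≈⟨ headSum-+ ex h _ _ ⟨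
    headSum ex h (λ y → sumAvoiding (y ∷ ex) g * D (y ∷ ex) hs + g y * D (y ∷ ex) hs)
      ≈⟨ headSum-congᵖ ex h (λ y y∉ex → trans (sym (distribʳ _ _ _)) (*-congʳ (sumAvoiding-∷ ex y g y∉ex))) ⟩
    headSum ex h (λ y → sumAvoiding ex g * D (y ∷ ex) hs)
      ≈⟨ headSum-*ˡ ex h (sumAvoiding ex g) _ ⟩
    sumAvoiding ex g * D ex (h ∷ hs) ∎
    where
    D = distinctSum
    M = merges g hs
    gh = λ x → g x * h x
    gh-head : D ex (gh ∷ hs) ≈ headSum ex h (λ y → g y * D (y ∷ ex) hs)
    gh-head = ∑-cong U (λ y → when-cong (y ∉? ex) (trans (*-congʳ (*-comm (g y) (h y))) (*-assoc (h y) (g y) _)))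

  module Powers (φ : ℕ → A → Carrier) (φ-suc : ∀ m x → φ m x * φ 1 x ≈ φ (suc m) x) where
    open CanonicalMaps R
    open CycleFactors using (fallingFactorial)
    open import Algebra.Properties.Ring ring using (-‿distribˡ-*; -‿distribʳ-*; -1*x≈-x)
    open import Algebra.Properties.Group +-group using (//-rightDividesʳ)

    Distinct : List A → ℕ → Carrier
    Distinct ex r = distinctSum ex (replicate r (φ 1))

    DistinctWith : List A → ℕ → ℕ → Carrier
    DistinctWith ex m r = distinctSum ex (φ m ∷ replicate r (φ 1))

    powerSum : ℕ → Carrier
    powerSum m = sumAvoiding [] (φ m)

    ∑-merges-replicate : ∀ m r ex →
      ∑ (merges (φ m) (replicate (suc r) (φ 1))) (distinctSum ex) ≈ nat (suc r) * DistinctWith ex (suc m) r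
    ∑-merges-replicate m zero ex =
      trans (+-identityʳ _) (trans (distinctSum-cong-head [] ex (φ-suc m)) (sym (trans (*-congʳ (+-identityʳ 1#)) (*-identityˡ _))))
    ∑-merges-replicate m (suc r) ex = begin
      distinctSum ex ((λ x → φ m x * φ 1 x) ∷ ones) + ∑ (map (φ 1 ∷_) M) (distinctSum ex)
        ≈⟨ +-cong (distinctSum-cong-head ones ex (φ-suc m)) (∑-map M (φ 1 ∷_) (distinctSum ex)) ⟩
      DistinctWith ex (suc m) (suc r) + ∑ M (λ l → distinctSum ex (φ 1 ∷ l))
        ≈⟨ +-congˡ (∑-headSum M ex (φ 1) (λ l y → distinctSum (y ∷ ex) l)) ⟩
      DistinctWith ex (suc m) (suc r) + headSum ex (φ 1) (λ y → ∑ M (distinctSum (y ∷ ex)))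
        ≈⟨ +-congˡ (headSum-congᵖ ex (φ 1) (λ y _ → ∑-merges-replicate m r (y ∷ ex))) ⟩
      DistinctWith ex (suc m) (suc r) + headSum ex (φ 1) (λ y → nat (suc r) * DistinctWith (y ∷ ex) (suc m) r)
        ≈⟨ +-congˡ (headSum-*ˡ ex (φ 1) (nat (suc r)) _) ⟩
      DistinctWith ex (suc m) (suc r) + nat (suc r) * distinctSum ex (φ 1 ∷ φ (suc m) ∷ replicate r (φ 1))
        ≈⟨ +-congˡ (*-congˡ (distinctSum-swap (φ 1) (φ (suc m)) (replicate r (φ 1)) ex)) ⟩
      DistinctWith ex (suc m) (suc r) + nat (suc r) * DistinctWith ex (suc m) (suc r)
        ≈⟨ trans (distribʳ _ _ _) (+-congʳ (*-identityˡ _)) ⟨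
      nat (suc (suc r)) * DistinctWith ex (suc m) (suc r) ∎
      where
      ones = replicate (suc r) (φ 1)
      M = merges (φ m) ones

    DistinctWith-suc : ∀ m r ex → DistinctWith ex m (suc r) ≈
                       sumAvoiding ex (φ m) * Distinct ex (suc r) - nat (suc r) * DistinctWith ex (suc m) r
    DistinctWith-suc m r ex = trans (sym (//-rightDividesʳ (nat (suc r) * DistinctWith ex (suc m) r) _))
      (+-congʳ (trans (+-congˡ (sym (∑-merges-replicate m r ex))) (distinctSum-merge (replicate (suc r) (φ 1)) ex (φ m))))

    DistinctWith-zero : ∀ m ex → DistinctWith ex m 0 ≈ sumAvoiding ex (φ m)
    DistinctWith-zero m ex = trans (sym (+-identityʳ _)) (trans (distinctSum-merge [] ex (φ m)) (*-identityʳ _))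

    newtonTerm : ℕ → ℕ → ℕ → Carrier
    newtonTerm m i j = pow (- 1#) i * (nat (fallingFactorial (i ℕ.+ j) i) * (powerSum (m ℕ.+ i) * Distinct [] j))

    DistinctWith-expansion : ∀ r m → DistinctWith [] m r ≈ conv (newtonTerm m) r
    DistinctWith-expansion zero m = begin
      DistinctWith [] m 0                  ≈⟨ DistinctWith-zero m [] ⟩
      powerSum m                           ≈⟨ trans (*-identityʳ _) (reflexive (≡.cong powerSum (NP.+-identityʳ m))) ⟨
      powerSum (m ℕ.+ 0) * 1#              ≈⟨ trans (*-identityˡ _) (trans (*-congʳ (+-identityʳ 1#)) (*-identityˡ _)) ⟨
      newtonTerm m 0 0                     ∎
    DistinctWith-expansion (suc r) m = begin
      DistinctWith [] m (suc r)
        ≈⟨ DistinctWith-suc m r [] ⟩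
      powerSum m * Distinct [] (suc r) - nat (suc r) * DistinctWith [] (suc m) r
        ≈⟨ +-cong first (trans (-‿distribˡ-* _ _) (*-congˡ (DistinctWith-expansion r (suc m)))) ⟩
      newtonTerm m 0 (suc r) + (- nat (suc r)) * conv (newtonTerm (suc m)) r
        ≈⟨ +-congˡ (trans (conv-*ˡ r (- nat (suc r)) _) (conv-cong r shift)) ⟩
      conv (newtonTerm m) (suc r) ∎
      where
      first : powerSum m * Distinct [] (suc r) ≈ newtonTerm m 0 (suc r)
      first = sym (trans (*-identityˡ _) (trans (*-congʳ (+-identityʳ 1#)) (trans (*-identityˡ _)
                (reflexive (≡.cong (λ v → powerSum v * Distinct [] (suc r)) (NP.+-identityʳ m))))))
      reorder : ∀ n s f x → (- n) * (s * (f * x)) ≈ (- s) * ((n * f) * x)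
      reorder n s f x = trans (sym (-‿distribˡ-* n _)) (trans (-‿cong (x∙yz≈y∙xz n s _))
        (trans (-‿cong (*-congˡ (sym (*-assoc n f x)))) (-‿distribˡ-* s _)))
      shift : ∀ i j → i ℕ.+ j ≡ r → (- nat (suc r)) * newtonTerm (suc m) i j ≈ newtonTerm m (suc i) j
      shift i j ≡.refl = begin
        (- nat (suc (i ℕ.+ j))) * (pow (- 1#) i * (nat f * (powerSum (suc m ℕ.+ i) * Distinct [] j)))
          ≈⟨ reorder (nat (suc (i ℕ.+ j))) (pow (- 1#) i) (nat f) _ ⟩
        (- pow (- 1#) i) * ((nat (suc (i ℕ.+ j)) * nat f) * (powerSum (suc m ℕ.+ i) * Distinct [] j))
          ≈⟨ *-cong (sym (-1*x≈-x _)) (*-cong (sym (nat-* (suc (i ℕ.+ j)) f))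
               (*-congʳ (reflexive (≡.cong powerSum (≡.sym (NP.+-suc m i)))))) ⟩
        newtonTerm m (suc i) j ∎
        where f = fallingFactorial (i ℕ.+ j) i

    sign-reassoc : ∀ u v f d z → u * (f * ((- d) * (v * z))) ≈ (- 1# * (u * v)) * (f * (d * z))
    sign-reassoc u v f d z = begin
      u * (f * ((- d) * (v * z)))      ≈⟨ *-congˡ (trans (*-congˡ (sym (-‿distribˡ-* d _))) (sym (-‿distribʳ-* f _))) ⟩
      u * - (f * (d * (v * z)))        ≈⟨ -‿distribʳ-* u _ ⟨
      - (u * (f * (d * (v * z))))      ≈⟨ -‿cong (trans (*-congˡ (trans (*-congˡ (x∙yz≈y∙xz d v z)) (x∙yz≈y∙xz f v _))) (sym (*-assoc u v _))) ⟩
      - ((u * v) * (f * (d * z)))      ≈⟨ trans (-‿distribˡ-* (u * v) _) (*-congʳ (sym (-1*x≈-x _))) ⟩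
      (- 1# * (u * v)) * (f * (d * z)) ∎

    Distinct≈Z : ∀ (δ : ℕ → ℤ) → (∀ i → powerSum (suc i) ≈ - int (δ (suc i))) →
                 ∀ k → Distinct [] k ≈ int ((ℤ.- (+ 1)) ℤ.^ k ℤ.* Z k δ)
    Distinct≈Z δ powerSum≈-δ = <-rec _ step
      where
      open CycleIndexRecurrence δ using (Z-suc)
      step : ∀ k → (∀ {j} → j ℕ.< k → Distinct [] j ≈ int ((ℤ.- (+ 1)) ℤ.^ j ℤ.* Z j δ)) →
             Distinct [] k ≈ int ((ℤ.- (+ 1)) ℤ.^ k ℤ.* Z k δ)
      step zero    _   = sym (+-identityʳ 1#)
      step (suc k) rec = begin
        Distinct [] (suc k)                                  ≈⟨ DistinctWith-expansion k 1 ⟩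
        conv (newtonTerm 1) k                                ≈⟨ conv-cong k term ⟩
        conv (λ i j → pow (- 1#) (suc k) * int (F i j)) k    ≈⟨ conv-*ˡ k (pow (- 1#) (suc k)) _ ⟨
        pow (- 1#) (suc k) * conv (λ i j → int (F i j)) k    ≈⟨ *-cong (int-[-1]^ (suc k)) (int-conv k F) ⟨
        int ((ℤ.- (+ 1)) ℤ.^ suc k) * int (ℤconv F k)        ≈⟨ int-* ((ℤ.- (+ 1)) ℤ.^ suc k) (ℤconv F k) ⟨
        int ((ℤ.- (+ 1)) ℤ.^ suc k ℤ.* ℤconv F k)            ≡⟨ ≡.cong (λ z → int ((ℤ.- (+ 1)) ℤ.^ suc k ℤ.* z)) (Z-suc k) ⟨
        int ((ℤ.- (+ 1)) ℤ.^ suc k ℤ.* Z (suc k) δ)          ∎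
        where
        ℤconv = RingSums.conv ZP.+-*-commutativeRing
        F : ℕ → ℕ → ℤ
        F i j = + fallingFactorial (i ℕ.+ j) i ℤ.* (δ (suc i) ℤ.* Z j δ)
        term : ∀ i j → i ℕ.+ j ≡ k → newtonTerm 1 i j ≈ pow (- 1#) (suc k) * int (F i j)
        term i j ≡.refl = begin
          pow (- 1#) i * (nat f * (powerSum (suc i) * Distinct [] j))
            ≈⟨ *-congˡ (*-congˡ (*-cong (powerSum≈-δ i)
                 (trans (rec (ℕ.s≤s (NP.m≤n+m j i))) (trans (int-* ((ℤ.- (+ 1)) ℤ.^ j) (Z j δ)) (*-congʳ (int-[-1]^ j)))))) ⟩
          pow (- 1#) i * (nat f * ((- int (δ (suc i))) * (pow (- 1#) j * int (Z j δ))))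
            ≈⟨ sign-reassoc (pow (- 1#) i) (pow (- 1#) j) (nat f) (int (δ (suc i))) (int (Z j δ)) ⟩
          (- 1# * (pow (- 1#) i * pow (- 1#) j)) * (nat f * (int (δ (suc i)) * int (Z j δ)))
            ≈⟨ *-cong (*-congˡ (pow-+ (- 1#) i j)) (trans (int-* (+ f) _) (*-congˡ (int-* (δ (suc i)) (Z j δ)))) ⟨
          pow (- 1#) (suc (i ℕ.+ j)) * int (F i j) ∎
          where f = fallingFactorial (i ℕ.+ j) i

module CharacterSums {c ℓ : Level} (R : CommutativeRing c ℓ) (n p : ℕ) (ψ : G n p → CommutativeRing.Carrier R) where
  open CommutativeRing R
  open SetoidReasoning setoid
  open RingSums R
  open CanonicalMaps R
  open import Data.List.Relation.Unary.Unique.Propositional.Properties using (allFin⁺)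
  open import Data.List.Membership.Propositional.Properties using (∈-allFin)
  import Data.List.Relation.Unary.Unique.DecPropositional as UniqueDec
  open import Data.List.Membership.Propositional using (_∈_)

  U : List (G n p)
  U = allFin (Np n p)

  open DistinctSums R Fin._≟_ U (allFin⁺ (Np n p)) ∈-allFin public

  D? : (x : G n p) → Dec (InD n p x)
  D? x = ¬? (p ∣? toℕ x)

  φ : ℕ → G n p → Carrier
  φ m x = when (D? x) (pow (ψ x) m)

  φ-suc : ∀ m x → φ m x * φ 1 x ≈ φ (suc m) x
  φ-suc m x = trans (when-* (D? x) (D? x) _ _) (trans (when-⇔ (D? x ×-dec D? x) (D? x) _ proj₁ (λ d → d , d))
                 (when-cong (D? x) (trans (*-congˡ (*-identityʳ _)) (*-comm _ _))))

  open Powers φ φ-suc public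

  Fresh : List (G n p) → ∀ {k} → Vec (G n p) k → Set
  Fresh ex v = All (λ z → ¬ z ∈ ex) (toList v) × Unique (toList v)

  Fresh? : ∀ ex {k} (v : Vec (G n p) k) → Dec (Fresh ex v)
  Fresh? ex v = All.all? (_∉? ex) (toList v) ×-dec UniqueDec.unique? Fin._≟_ (toList v)

  Fresh-∷⁻ : ∀ {ex x k} (v : Vec (G n p) k) → Fresh ex (x ∷ v) → ¬ x ∈ ex × Fresh (x ∷ ex) v
  Fresh-∷⁻ {ex} {x} v ((x∉ex ∷ v∉ex) , (x∉v ∷ v-unique)) = x∉ex , (fresh v∉ex x∉v , v-unique)
    where
    fresh : ∀ {l} → All (λ z → ¬ z ∈ ex) l → All (x ≢_) l → All (λ z → ¬ z ∈ x ∷ ex) l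
    fresh []         []         = []
    fresh (a ∷ as) (b ∷ bs) = (λ { (here e) → b (≡.sym e) ; (there m) → a m }) ∷ fresh as bs

  Fresh-∷⁺ : ∀ {ex x k} (v : Vec (G n p) k) → ¬ x ∈ ex × Fresh (x ∷ ex) v → Fresh ex (x ∷ v)
  Fresh-∷⁺ v (x∉ex , (v∉ , v-unique)) =
    (x∉ex ∷ All.map (λ z∉ z∈ → z∉ (there z∈)) v∉) , (All.map (λ z∉ e → z∉ (here (≡.sym e))) v∉ ∷ v-unique)

  ∏φ : ∀ {k} → Vec (G n p) k → Carrier
  ∏φ v = prodR R (map (φ 1) (toList v))

  ∑-fresh≈Distinct : ∀ k ex → ∑ (tuples U k) (λ v → when (Fresh? ex v) (∏φ v)) ≈ Distinct ex k
  ∑-fresh≈Distinct zero    ex = trans (+-identityʳ _) (when-yes (Fresh? ex []) _ ([] , []))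
  ∑-fresh≈Distinct (suc k) ex = begin
    ∑ (concatMap (λ x → map (x ∷_) (tuples U k)) U) (λ v → when (Fresh? ex v) (∏φ v))
      ≈⟨ ∑-concatMap U (λ x → map (x ∷_) (tuples U k)) _ ⟩
    ∑ U (λ x → ∑ (map (x ∷_) (tuples U k)) (λ v → when (Fresh? ex v) (∏φ v)))
      ≈⟨ ∑-cong U (λ x → ∑-map (tuples U k) (x ∷_) _) ⟩
    ∑ U (λ x → ∑ (tuples U k) (λ v → when (Fresh? ex (x ∷ v)) (φ 1 x * ∏φ v)))
      ≈⟨ ∑-cong U (λ x → ∑-cong (tuples U k) (λ v →
           when-⇔ (Fresh? ex (x ∷ v)) (x ∉? ex ×-dec Fresh? (x ∷ ex) v) _ (Fresh-∷⁻ v) (Fresh-∷⁺ v))) ⟩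
    ∑ U (λ x → ∑ (tuples U k) (λ v → when (x ∉? ex ×-dec Fresh? (x ∷ ex) v) (φ 1 x * ∏φ v)))
      ≈⟨ ∑-cong U (λ x → ∑-cong (tuples U k) (λ v →
           sym (trans (when-cong (x ∉? ex) (when-*ˡ (Fresh? (x ∷ ex) v) (φ 1 x) _)) (when-when (x ∉? ex) (Fresh? (x ∷ ex) v) _)))) ⟩
    ∑ U (λ x → ∑ (tuples U k) (λ v → when (x ∉? ex) (φ 1 x * when (Fresh? (x ∷ ex) v) (∏φ v))))
      ≈⟨ ∑-cong U (λ x → sym (trans (when-cong (x ∉? ex) (∑-*ˡ (tuples U k) (φ 1 x) _)) (when-∑ (x ∉? ex) (tuples U k) _))) ⟩
    headSum ex (φ 1) (λ x → ∑ (tuples U k) (λ v → when (Fresh? (x ∷ ex) v) (∏φ v)))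
      ≈⟨ headSum-congᵖ ex (φ 1) (λ x _ → ∑-fresh≈Distinct k (x ∷ ex)) ⟩
    Distinct ex (suc k) ∎

  ∏φ≈when-∏ψ : ∀ (l : List (G n p)) → prodR R (map (φ 1) l) ≈ when (All.all? D? l) (prodR R (map ψ l))
  ∏φ≈when-∏ψ []      = sym (when-yes (All.all? D? []) _ [])
  ∏φ≈when-∏ψ (x ∷ l) = begin
    φ 1 x * prodR R (map (φ 1) l)
      ≈⟨ *-congˡ (∏φ≈when-∏ψ l) ⟩
    when (D? x) (ψ x * 1#) * when (All.all? D? l) (prodR R (map ψ l))
      ≈⟨ when-* (D? x) (All.all? D? l) _ _ ⟩
    when (D? x ×-dec All.all? D? l) ((ψ x * 1#) * prodR R (map ψ l))
      ≈⟨ when-⇔ (D? x ×-dec All.all? D? l) (All.all? D? (x ∷ l)) _ (λ (a , b) → a ∷ b) (λ { (a ∷ b) → a , b }) ⟩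
    when (All.all? D? (x ∷ l)) ((ψ x * 1#) * prodR R (map ψ l))
      ≈⟨ when-cong (All.all? D? (x ∷ l)) (*-congʳ (*-identityʳ _)) ⟩
    when (All.all? D? (x ∷ l)) (ψ x * prodR R (map ψ l)) ∎

  Fψ≈Distinct : ∀ k → Fψ R n p ψ (Xbar n p k) ≈ Distinct [] k
  Fψ≈Distinct k = begin
    Fψ R n p ψ (Xbar n p k)                                         ≈⟨ ∑-filter (InXbar? n p k) (tuples U k) ∏ψ ⟩
    ∑ (tuples U k) (λ v → when (InXbar? n p k v) (∏ψ v))            ≈⟨ ∑-cong (tuples U k) restrict ⟨
    ∑ (tuples U k) (λ v → when (Fresh? [] v) (∏φ v))               ≈⟨ ∑-fresh≈Distinct k [] ⟩
    Distinct [] k                                                   ∎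
    where
    ∏ψ : Vec (G n p) k → Carrier
    ∏ψ v = prodR R (map ψ (toList v))
    restrict : ∀ v → when (Fresh? [] v) (∏φ v) ≈ when (InXbar? n p k v) (∏ψ v)
    restrict v = begin
      when (Fresh? [] v) (∏φ v)                                      ≈⟨ when-cong (Fresh? [] v) (∏φ≈when-∏ψ (toList v)) ⟩
      when (Fresh? [] v) (when (All.all? D? (toList v)) (∏ψ v))      ≈⟨ when-when (Fresh? [] v) (All.all? D? (toList v)) _ ⟩
      when (Fresh? [] v ×-dec All.all? D? (toList v)) (∏ψ v)
        ≈⟨ when-⇔ (Fresh? [] v ×-dec All.all? D? (toList v)) (InXbar? n p k v) _
             (λ ((_ , u) , a) → a , u) (λ (a , u) → (All.map (λ _ ()) a , u) , a) ⟩
      when (InXbar? n p k v) (∏ψ v)                                  ∎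

module GeometricSums {c ℓ : Level} (R : CommutativeRing c ℓ) where
  open CommutativeRing R
  open SetoidReasoning setoid
  open RingSums R
  open CanonicalMaps R
  open import Algebra.Properties.Ring ring using (-‿distribˡ-*; -1*x≈-x)
  open import Algebra.Properties.Group +-group using (∙-cancelʳ; x∙y⁻¹≈ε⇒x≈y)

  z*∑pow+1≈∑pow+z^ : ∀ z M → z * ∑< M (pow z) + 1# ≈ ∑< M (pow z) + pow z M
  z*∑pow+1≈∑pow+z^ z zero    = +-congʳ (zeroʳ z)
  z*∑pow+1≈∑pow+z^ z (suc M) = begin
    z * ∑< (suc M) (pow z) + 1#      ≈⟨ +-congʳ (trans (*-congˡ (∑<-suc M (pow z))) (distribˡ z S _)) ⟩
    (z * S + pow z (suc M)) + 1#     ≈⟨ trans (+-assoc _ _ _) (trans (+-congˡ (+-comm _ _)) (sym (+-assoc _ _ _))) ⟩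
    (z * S + 1#) + pow z (suc M)     ≈⟨ +-congʳ (z*∑pow+1≈∑pow+z^ z M) ⟩
    (S + pow z M) + pow z (suc M)    ≈⟨ +-congʳ (∑<-suc M (pow z)) ⟨
    ∑< (suc M) (pow z) + pow z (suc M) ∎
    where S = ∑< M (pow z)

  ∑pow≈0 : IsIntegralDomain R → ∀ z M → pow z M ≈ 1# → ¬ (z ≈ 1#) → ∑< M (pow z) ≈ 0#
  ∑pow≈0 (_ , no-zero-divisors) z M z^M≈1 z≉1 with no-zero-divisors (z - 1#) S [z-1]*S≈0
    where
    S = ∑< M (pow z)
    z*S≈S : z * S ≈ S
    z*S≈S = ∙-cancelʳ 1# _ _ (trans (z*∑pow+1≈∑pow+z^ z M) (+-congˡ z^M≈1))
    [z-1]*S≈0 : (z - 1#) * S ≈ 0#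
    [z-1]*S≈0 = begin
      (z - 1#) * S        ≈⟨ distribʳ S z (- 1#) ⟩
      z * S + (- 1#) * S  ≈⟨ +-cong z*S≈S (-1*x≈-x S) ⟩
      S - S               ≈⟨ -‿inverseʳ S ⟩
      0#                  ∎
  ... | inj₁ z-1≈0 = ⊥-elim (z≉1 (x∙y⁻¹≈ε⇒x≈y z 1# z-1≈0))
  ... | inj₂ S≈0   = S≈0

  ∑pow1≈nat : ∀ z M → z ≈ 1# → ∑< M (pow z) ≈ nat M
  ∑pow1≈nat z zero    _   = refl
  ∑pow1≈nat z (suc M) z≈1 = +-congˡ (trans (∑<-cong M (λ a → trans (*-congʳ z≈1) (*-identityˡ _))) (∑pow1≈nat z M z≈1))

module CharacterPowerSums {c ℓ : Level} (R : CommutativeRing c ℓ) (domain : IsIntegralDomain R)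
         {p : ℕ} (p-prime : Prime p) (n : ℕ) (ψ : G n p → CommutativeRing.Carrier R)
         (character : IsCharacter R n p-prime ψ) (o : ℕ) (order : IsOrder R n p ψ o) where
  open CommutativeRing R
  open SetoidReasoning setoid
  open RingSums R
  open CanonicalMaps R
  open GeometricSums R
  open CharacterSums R n p ψ using (powerSum; φ; D?; _∉?_)
  open IsCharacter character
  open import Data.Nat.DivMod using (_%_; _/_; _mod_; %-distribˡ-+; m<n⇒m%n≡m; n%n≡0; m≡m%n+[m/n]*n; m%n<n)
  open import Data.Nat.Divisibility using (_∣_; divides; m%n≡0⇒n∣m; ∣n⇒∣m*n)
  open import Data.Fin.Properties using (toℕ-fromℕ<; toℕ-injective; toℕ<n)
  open import Algebra.Properties.Group +-group using (//-rightDividesʳ)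

  N : ℕ
  N = Np n p

  instance
    N≢0 : ℕ.NonZero N
    N≢0 = Np-nonZero n p-prime
    p≢0 : ℕ.NonZero p
    p≢0 = prime⇒nonZero p-prime
    o≢0 : ℕ.NonZero o
    o≢0 = ℕ.>-nonZero (proj₁ order)

  ζ : Carrier
  ζ = ψ (1 mod N)

  mod-≡ : ∀ a b → a % N ≡ b % N → a mod N ≡ b mod N
  mod-≡ a b e = toℕ-injective (≡.trans (toℕ-fromℕ< _) (≡.trans e (≡.sym (toℕ-fromℕ< _))))

  ψ-mod-+ : ∀ a b → ψ ((a ℕ.+ b) mod N) ≈ ψ (a mod N) * ψ (b mod N)
  ψ-mod-+ a b = trans (reflexive (≡.cong ψ (mod-≡ (a ℕ.+ b) (toℕ (a mod N) ℕ.+ toℕ (b mod N))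
      (≡.trans (%-distribˡ-+ a b N)
               (≡.cong₂ (λ u v → (u ℕ.+ v) % N) (≡.sym (toℕ-fromℕ< (m%n<n a N))) (≡.sym (toℕ-fromℕ< (m%n<n b N))))))))
    (hom (a mod N) (b mod N))

  ψ-mod≈ζ^ : ∀ a → ψ (a mod N) ≈ pow ζ a
  ψ-mod≈ζ^ zero    = unit
  ψ-mod≈ζ^ (suc a) = trans (ψ-mod-+ 1 a) (*-congˡ (ψ-mod≈ζ^ a))

  ψ≈ζ^ : ∀ x → ψ x ≈ pow ζ (toℕ x)
  ψ≈ζ^ x = trans (reflexive (≡.cong ψ (toℕ-injective (≡.sym (≡.trans (toℕ-fromℕ< _) (m<n⇒m%n≡m (toℕ<n x)))))))
                 (ψ-mod≈ζ^ (toℕ x))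

  ζ^N≈1 : pow ζ N ≈ 1#
  ζ^N≈1 = trans (sym (ψ-mod≈ζ^ N))
    (trans (reflexive (≡.cong ψ (mod-≡ N 0 (≡.trans (n%n≡0 N) (≡.sym (m<n⇒m%n≡m (ℕ.>-nonZero⁻¹ N))))))) unit)

  o∣⇒ζ^≈1 : ∀ m → o ∣ m → pow ζ m ≈ 1#
  o∣⇒ζ^≈1 m (divides q ≡.refl) = trans (reflexive (≡.cong (pow ζ) (NP.*-comm q o)))
    (trans (pow-* ζ o q) (trans (pow-cong q (proj₁ (proj₂ order) (1 mod N))) (pow-1# q)))

  -- The remainder m % o also kills every value of ψ, so minimality of o forces it to be 0.
  ζ^≈1⇒o∣ : ∀ m → pow ζ m ≈ 1# → o ∣ m
  ζ^≈1⇒o∣ m ζ^m≈1 with m % o ℕ.≟ 0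
  ... | yes r≡0 = m%n≡0⇒n∣m m o r≡0
  ... | no  r≢0 = ⊥-elim (NP.<⇒≱ (m%n<n m o) (proj₂ (proj₂ order) r (NP.n≢0⇒n>0 r≢0) ψ^r≈1))
    where
    r = m % o
    ζ^r≈1 : pow ζ r ≈ 1#
    ζ^r≈1 = begin
      pow ζ r                          ≈⟨ *-identityʳ _ ⟨
      pow ζ r * 1#                     ≈⟨ *-congˡ (o∣⇒ζ^≈1 ((m / o) ℕ.* o) (divides (m / o) ≡.refl)) ⟨
      pow ζ r * pow ζ ((m / o) ℕ.* o)  ≈⟨ pow-+ ζ r _ ⟨
      pow ζ (r ℕ.+ (m / o) ℕ.* o)      ≡⟨ ≡.cong (pow ζ) (m≡m%n+[m/n]*n m o) ⟨
      pow ζ m                          ≈⟨ ζ^m≈1 ⟩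
      1#                               ∎
    ψ^r≈1 : ∀ x → pow (ψ x) r ≈ 1#
    ψ^r≈1 x = trans (pow-cong r (ψ≈ζ^ x)) (trans (pow-comm ζ (toℕ x) r) (trans (pow-cong (toℕ x) ζ^r≈1) (pow-1# (toℕ x))))

  o∣N : o ∣ N
  o∣N = ζ^≈1⇒o∣ N ζ^N≈1

  ∑pow-ζ^ : ∀ m M → o ∣ m ℕ.* M → ∑< M (pow (pow ζ m)) ≈ when (o ∣? m) (nat M)
  ∑pow-ζ^ m M o∣mM with o ∣? m
  ... | yes o∣m = ∑pow1≈nat (pow ζ m) M (o∣⇒ζ^≈1 m o∣m)
  ... | no  o∤m = ∑pow≈0 domain (pow ζ m) M (trans (sym (pow-* ζ m M)) (o∣⇒ζ^≈1 (m ℕ.* M) o∣mM))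
                    (λ ζ^m≈1 → o∤m (ζ^≈1⇒o∣ m ζ^m≈1))

  -- Summing over D_p is summing over G minus summing over the multiples p b, 0 ≤ b ≤ n.
  powerSum≈ : ∀ m → powerSum m ≈ when (o ∣? m) (nat N) - when (o ∣? (m ℕ.* p)) (nat (suc n))
  powerSum≈ m = begin
    powerSum m
      ≈⟨ ∑-tabulate N (λ x → x) _ g (λ x → trans (when-yes (x ∉? []) _ (λ ()))
                                               (when-cong (D? x) (trans (pow-cong m (ψ≈ζ^ x)) (pow-comm ζ (toℕ x) m)))) ⟩
    ∑< N g
      ≈⟨ trans (sym (//-rightDividesʳ _ _)) (+-congʳ (∑<-when-¬ (p ∣?_) N (pow z))) ⟩
    ∑< N (pow z) - ∑< (suc n ℕ.* p) (λ a → when (p ∣? a) (pow z a))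
      ≈⟨ +-congˡ (-‿cong (trans (∑<-multiples p (suc n) (pow z)) (∑<-cong (suc n) (λ b → pow-* z p b)))) ⟩
    ∑< N (pow z) - ∑< (suc n) (pow (pow z p))
      ≈⟨ +-congˡ (-‿cong (∑<-cong (suc n) (λ b → pow-cong b (sym (pow-* ζ m p))))) ⟩
    ∑< N (pow z) - ∑< (suc n) (pow (pow ζ (m ℕ.* p)))
      ≈⟨ +-cong (∑pow-ζ^ m N (∣n⇒∣m*n m o∣N))
                (-‿cong (∑pow-ζ^ (m ℕ.* p) (suc n) (≡.subst (o ∣_) (mN≡mp[1+n] m) (∣n⇒∣m*n m o∣N)))) ⟩
    when (o ∣? m) (nat N) - when (o ∣? (m ℕ.* p)) (nat (suc n)) ∎
    where
    z = pow ζ m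
    g = λ a → when (¬? (p ∣? a)) (pow z a)
    mN≡mp[1+n] : ∀ m → m ℕ.* N ≡ m ℕ.* p ℕ.* suc n
    mN≡mp[1+n] m = ≡.trans (≡.cong (m ℕ.*_) (NP.*-comm (suc n) p)) (≡.sym (NP.*-assoc m p (suc n)))

module PowerSumsAsδ {c ℓ : Level} (R : CommutativeRing c ℓ) (domain : IsIntegralDomain R)
         {p : ℕ} (p-prime : Prime p) (n : ℕ) (ψ : G n p → CommutativeRing.Carrier R)
         (character : IsCharacter R n p-prime ψ) (o : ℕ) (order : IsOrder R n p ψ o) where
  open CommutativeRing R
  open SetoidReasoning setoid
  open RingSums R
  open CanonicalMaps R
  open CharacterSums R n p ψ using (powerSum)
  open CharacterPowerSums R domain p-prime n ψ character o order
  open import Algebra.Properties.Ring ring using (-0#≈0#; -‿involutive)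
  open import Data.Nat.DivMod using (_/_; m*n/n≡m; m/n*n≡m)
  open import Data.Nat.Divisibility using (_∣_; ∣-trans; m∣m*n; ∣m⇒∣m*n; *-monoˡ-∣; *-cancelʳ-∣)
  open import Data.Nat.Coprimality using (Coprime; coprime-divisor)
  open import Data.Nat.Primality using (prime⇒irreducible)
  open import Data.Nat.Tactic.RingSolver using (solve-∀)

  Np/p≡1+n : Np/p n p-prime o ≡ suc n
  Np/p≡1+n = m*n/n≡m (suc n) p

  0-0≈-int0 : 0# - 0# ≈ - int (+ 0)
  0-0≈-int0 = +-identityˡ _

  N-[1+n]≈-int-big : nat N - nat (suc n) ≈ - int (ℤ.- (+ (p ℕ.∸ 1) ℤ.* + Np/p n p-prime o))
  N-[1+n]≈-int-big = begin
    nat N - nat (suc n)                           ≡⟨ ≡.cong (λ v → nat v - nat (suc n)) (N≡[p-1][1+n]+[1+n] p) ⟩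
    nat ((p ℕ.∸ 1) ℕ.* suc n ℕ.+ suc n) - nat (suc n)
      ≈⟨ trans (+-congʳ (nat-+ ((p ℕ.∸ 1) ℕ.* suc n) (suc n))) (//-rightDividesʳ (nat (suc n)) _) ⟩
    nat ((p ℕ.∸ 1) ℕ.* suc n)                     ≡⟨ ≡.cong (λ v → nat ((p ℕ.∸ 1) ℕ.* v)) Np/p≡1+n ⟨
    nat ((p ℕ.∸ 1) ℕ.* Np/p n p-prime o)            ≡⟨ ≡.cong int (ZP.pos-* (p ℕ.∸ 1) (Np/p n p-prime o)) ⟩
    int (+ (p ℕ.∸ 1) ℤ.* + Np/p n p-prime o)        ≈⟨ -‿involutive _ ⟨
    - - int (+ (p ℕ.∸ 1) ℤ.* + Np/p n p-prime o)    ≈⟨ -‿cong (int-neg (+ (p ℕ.∸ 1) ℤ.* + Np/p n p-prime o)) ⟨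
    - int (ℤ.- (+ (p ℕ.∸ 1) ℤ.* + Np/p n p-prime o)) ∎
    where
    open import Algebra.Properties.Group +-group using (//-rightDividesʳ)
    [1+n][1+q]≡q[1+n]+[1+n] : ∀ q n → suc n ℕ.* suc q ≡ q ℕ.* suc n ℕ.+ suc n
    [1+n][1+q]≡q[1+n]+[1+n] = solve-∀
    N≡[p-1][1+n]+[1+n] : ∀ q → .{{ℕ.NonZero q}} → suc n ℕ.* q ≡ (q ℕ.∸ 1) ℕ.* suc n ℕ.+ suc n
    N≡[p-1][1+n]+[1+n] (suc q) = [1+n][1+q]≡q[1+n]+[1+n] q n

  powerSum≈-δ₁ : ¬ p ∣ o → ∀ m → powerSum m ≈ - int (δ₁ n p-prime o m)
  powerSum≈-δ₁ p∤o m = trans (powerSum≈ m) (evaluate m)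
    where
    coprime : Coprime o p
    coprime (d∣o , d∣p) with prime⇒irreducible p-prime d∣p
    ... | inj₁ d≡1    = d≡1
    ... | inj₂ ≡.refl = ⊥-elim (p∤o d∣o)
    evaluate : ∀ m → when (o ∣? m) (nat N) - when (o ∣? (m ℕ.* p)) (nat (suc n)) ≈ - int (δ₁ n p-prime o m)
    evaluate m with o ∣? m | o ∣? (m ℕ.* p)
    ... | yes _   | yes _    = N-[1+n]≈-int-big
    ... | yes o∣m | no o∤mp  = ⊥-elim (o∤mp (∣m⇒∣m*n p o∣m))
    ... | no o∤m  | yes o∣mp = ⊥-elim (o∤m (coprime-divisor coprime (≡.subst (o ∣_) (NP.*-comm m p) o∣mp)))
    ... | no _    | no _     = 0-0≈-int0

  powerSum≈-δ₂ : p ∣ o → ∀ m → powerSum m ≈ - int (δ₂ n p-prime o m)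
  powerSum≈-δ₂ p∣o m = trans (powerSum≈ m) (evaluate m)
    where
    q = o / p
    q*p≡o : q ℕ.* p ≡ o
    q*p≡o = m/n*n≡m p∣o
    q∣⇒o∣*p : ∀ m → q ∣ m → o ∣ m ℕ.* p
    q∣⇒o∣*p m q∣m = ≡.subst (_∣ m ℕ.* p) q*p≡o (*-monoˡ-∣ p q∣m)
    o∣*p⇒q∣ : ∀ m → o ∣ m ℕ.* p → q ∣ m
    o∣*p⇒q∣ m o∣mp = *-cancelʳ-∣ p (≡.subst (_∣ m ℕ.* p) (≡.sym q*p≡o) o∣mp)
    evaluate : ∀ m → when (o ∣? m) (nat N) - when (o ∣? (m ℕ.* p)) (nat (suc n)) ≈ - int (δ₂ n p-prime o m)
    evaluate m with q ∣? m | o ∣? m | o ∣? (m ℕ.* p)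
    ... | no q∤m  | yes o∣m | _        = ⊥-elim (q∤m (∣-trans (≡.subst (q ∣_) q*p≡o (m∣m*n p)) o∣m))
    ... | no q∤m  | no _    | yes o∣mp = ⊥-elim (q∤m (o∣*p⇒q∣ m o∣mp))
    ... | no _    | no _    | no _     = 0-0≈-int0
    ... | yes q∣m | _       | no o∤mp  = ⊥-elim (o∤mp (q∣⇒o∣*p m q∣m))
    ... | yes _   | no _    | yes _    = trans (+-identityˡ _) (-‿cong (reflexive (≡.cong nat (≡.sym Np/p≡1+n))))
    ... | yes _   | yes _   | yes _    = N-[1+n]≈-int-big

open import Level using (Level)
open import Data.Nat using (ℕ; _≤_)
open import Data.Nat.Divisibility using (_∣_)
open import Data.Nat.Primality using (Prime)
open import Data.Integer using (+_; -_; _^_; _*_)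
open import Data.Product using (_×_)
open import Relation.Nullary using (¬_)
open import Algebra.Bundles using (CommutativeRing)

lemma5p5 : ∀ {c ℓ : Level} (R : CommutativeRing c ℓ) →
    IsIntegralDomain R → CharZero R →
    (p : ℕ) (pp : Prime p) → 3 ≤ p →
    (n : ℕ) → 1 ≤ n →
    (ψ : G n p → CommutativeRing.Carrier R) → IsCharacter R n pp ψ →
    (o : ℕ) → IsOrder R n p ψ o →
    (k : ℕ) → 1 ≤ k →
    (¬ (p ∣ o) →
      CommutativeRing._≈_ R (Fψ R n p ψ (Xbar n p k))
        (intR R ((- (+ 1)) ^ k * Z k (δ₁ n pp o))))
    × (p ∣ o →
      CommutativeRing._≈_ R (Fψ R n p ψ (Xbar n p k))
        (intR R ((- (+ 1)) ^ k * Z k (δ₂ n pp o))))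
lemma5p5 R domain _ p p-prime _ n _ ψ character o order k _ =
    (λ p∤o → trans (Fψ≈Distinct k) (Distinct≈Z (δ₁ n p-prime o) (λ i → powerSum≈-δ₁ p∤o (suc i)) k))
  , (λ p∣o → trans (Fψ≈Distinct k) (Distinct≈Z (δ₂ n p-prime o) (λ i → powerSum≈-δ₂ p∣o (suc i)) k))
  where
  open CommutativeRing R using (trans)
  open CharacterSums R n p ψ using (Fψ≈Distinct; Distinct≈Z)
  open PowerSumsAsδ R domain p-prime n ψ character o order using (powerSum≈-δ₁; powerSum≈-δ₂)
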